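{- Let $\sigma\in\Sigma$, $I\subset\{\varphi_0,\dots,\varphi_{n-1}\}$ of cardinality $i\in\{1,\dots,n-1\}$ and $\mathfrak R$ a refinement compatible with $I$. If $s_i$ appears with multiplicity $1$ in some reduced expression of $w_{\mathfrak R,\sigma}w_0$, then there is a refinement $\mathfrak R'$ compatible with $I$ such that $w_{\mathfrak R',\sigma}w_0$ is of one of the forms $s_i$, $s_is_{i-1}\cdots s_{i-\delta^- }$ ($\delta^->0$), $s_is_{i+1}\cdots s_{i+\delta^+}$ ($\delta^+>0$), or $s_is_{i-1}\cdots s_{i-\delta^- }s_{i+1}\cdots s_{i+\delta^+}$ ($\delta^-,\delta^+>0$).
   Context: $D_\sigma$ is an $n$-dimensional $E$-vector space ($n\ge2$) with an $E$-linear operator $\varphi^f$ with pairwise distinct eigenvalues $\varphi_0,\dots,\varphi_{n-1}$ (indeed $\varphi_j\varphi_k^{ -1}\notin\{1,p^f\}$ for $j\neq k$), eigenbasis $e_0,\dots,e_{n-1}$ ($\varphi^f(e_j)=\varphi_je_j$), and a full flag $\mathrm{Fil}^{ -h_{j,\sigma}}(D_\sigma)$ with $h_{0,\sigma}>\dots>h_{n-1,\sigma}$ and $\dim\mathrm{Fil}^{ -h_{j,\sigma}}(D_\sigma)=n-j$. A refinement is an ordering $\mathfrak R=(\varphi_{j_1},\dots,\varphi_{j_n})$ of the eigenvalues; it is compatible with $I$ if $I=\{\varphi_{j_1},\dots,\varphi_{j_{|I|}}\}$. With $e'_k=e_{j_k}$, let $g\in\mathrm{GL}_n(E)$ have first $k$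 columns spanning $\mathrm{Fil}^{ -h_{n-k,\sigma}}(D_\sigma)$ in the basis $(e'_1,\dots,e'_n)$ for each $k$; $w_{\mathfrak R,\sigma}\in S_n$ is the permutation with $g\in B(E)\dot wB(E)$ ($B$ upper triangular, $\dot we_k=e_{w(k)}$ on the standard basis). $s_j=(j,j+1)$ and $w_0$ is the longest element of $S_n$. -}

module Defs where

open import Level using (Level; _⊔_) renaming (suc to lsuc)
open import Algebra.Bundles using (CommutativeRing)
open import Data.Nat using (ℕ; zero; suc; _+_; _∸_; _≤_; _<_; _≡ᵇ_; _<?_)
open import Data.Bool using (if_then_else_)
open import Data.Fin using (Fin; toℕ; fromℕ<; opposite; _≟_)
import Data.Fin as Fin
open import Data.Fin.Subset using (Subset; _∈_)
open import Data.Fin.Permutation using (Permutation′; _⟨$⟩ʳ_)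
open import Data.List using (List; []; _∷_; _++_; map; length; upTo; foldr)
open import Data.List.Relation.Unary.All using (All)
open import Data.Product using (Σ; _×_; ∃; ∃-syntax)
open import Relation.Nullary using (¬_; Dec; yes; no)
open import Relation.Binary.PropositionalEquality using (_≡_)
open import Function using (_∘_; id)
open import Function.Bundles using (_⇔_)

record Field (c ℓ : Level) : Set (lsuc (c ⊔ ℓ)) where
  field
    commutativeRing : CommutativeRing c ℓ
  open CommutativeRing commutativeRing public
  field
    0≉1     : ¬ (0# ≈ 1#)
    inverse : ∀ x → ¬ (x ≈ 0#) → ∃[ y ] (x * y ≈ 1#)

module Matrices {c ℓ} (E : Field c ℓ) where
  open Field E using (Carrier; 0#; 1#) renaming (_+_ to _+ᴱ_; _*_ to _*ᴱ_; _≈_ to _≈ᴱ_)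

  Mat : ℕ → Set c
  Mat n = Fin n → Fin n → Carrier

  ∑ : ∀ {n} → (Fin n → Carrier) → Carrier
  ∑ {zero}  f = 0#
  ∑ {suc n} f = f Fin.zero +ᴱ ∑ (f ∘ Fin.suc)

  _·_ : ∀ {n} → Mat n → Mat n → Mat n
  (A · B) i j = ∑ (λ k → A i k *ᴱ B k j)

  _≈ᴹ_ : ∀ {n} → Mat n → Mat n → Set ℓ
  A ≈ᴹ B = ∀ i j → A i j ≈ᴱ B i j

  δ : ∀ {n} → Fin n → Fin n → Carrier
  δ i j with i ≟ j
  ... | yes _ = 1#
  ... | no  _ = 0#

  Id : ∀ {n} → Mat n
  Id = δ

  Invertible : ∀ {n} → Mat n → Set (c ⊔ ℓ)
  Invertible {n} A = ∃[ A⁻¹ ] ((A · A⁻¹) ≈ᴹ Id × (A⁻¹ · A) ≈ᴹ Id)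

  UpperTriangular : ∀ {n} → Mat n → Set ℓ
  UpperTriangular A = ∀ i j → toℕ j < toℕ i → A i j ≈ᴱ 0#

  InB : ∀ {n} → Mat n → Set (c ⊔ ℓ)
  InB A = UpperTriangular A × Invertible A

  permMat : ∀ {n} → Permutation′ n → Mat n
  permMat w i k = δ i (w ⟨$⟩ʳ k)

  InBruhatCell : ∀ {n} → Mat n → Permutation′ n → Set (c ⊔ ℓ)
  InBruhatCell g w = ∃[ b₁ ] ∃[ b₂ ] (InB b₁ × InB b₂ × g ≈ᴹ ((b₁ · permMat w) · b₂))

  -- The flag Fil^•(D_σ) on D_σ = E^n (coordinates in the eigenbasis
  -- e_0,…,e_{n-1}) is encoded by an invertible matrix F whose first k
  -- columns span the k-dimensional step Fil^{-h_{n-k,σ}}(D_σ), k=1..n.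
  --
  -- A refinement 𝔑 = (φ_{j_1},…,φ_{j_n}) is a permutation R of Fin n
  -- with R(k-1) = j_k.  In the basis e'_k = e_{j_k}, the coordinates of
  -- the columns of F are g k l = F (R k) l; so g is a matrix whose first
  -- k columns span Fil^{-h_{n-k,σ}} in the basis (e'_1,…,e'_n).
  gMat : ∀ {n} → Mat n → Permutation′ n → Mat n
  gMat F R k l = F (R ⟨$⟩ʳ k) l

  -- "w is w_{𝔑,σ}": g ∈ B(E) ẇ B(E)
  IsRelPos : ∀ {n} → Mat n → Permutation′ n → Permutation′ n → Set (c ⊔ ℓ)
  IsRelPos F R w = InBruhatCell (gMat F R) w

-- Combinatorics of S_n.  Positions are 1..n in the paper, 0..n-1 here.

-- the swap of positions j and j+1 (1-indexed), i.e. of j-1 and j (0-indexed)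
swapℕ : ℕ → ℕ → ℕ
swapℕ j m = if m ≡ᵇ (j ∸ 1) then j else (if m ≡ᵇ j then j ∸ 1 else m)

private
  toFinOr : ∀ {n} (m : ℕ) → Fin n → Dec (m < n) → Fin n
  toFinOr m k (yes p) = fromℕ< p
  toFinOr m k (no _)  = k

-- simple transposition s_j = (j, j+1), meaningful for 1 ≤ j ≤ n-1
s : ∀ {n} → ℕ → Fin n → Fin n
s {n} j k = toFinOr (swapℕ j (toℕ k)) k (swapℕ j (toℕ k) <? n)

w₀ : ∀ {n} → Fin n → Fin n
w₀ = opposite

ValidWord : ℕ → List ℕ → Set
ValidWord n ws = All (λ j → 1 ≤ j × j + 1 ≤ n) ws

wordProd : ∀ {n} → List ℕ → Fin n → Fin n
wordProd []       = id
wordProd (j ∷ ws) = s j ∘ wordProd ws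

_≗_ : ∀ {n} → (Fin n → Fin n) → (Fin n → Fin n) → Set
f ≗ g = ∀ k → f k ≡ g k

ReducedExpr : ∀ {n} → (Fin n → Fin n) → List ℕ → Set
ReducedExpr {n} v ws =
  ValidWord n ws × wordProd ws ≗ v ×
  (∀ ws′ → ValidWord n ws′ → wordProd ws′ ≗ v → length ws ≤ length ws′)

count : ℕ → List ℕ → ℕ
count i = foldr (λ j r → if j ≡ᵇ i then suc r else r) 0

desc : ℕ → ℕ → List ℕ
desc i d = map (λ t → i ∸ t) (upTo (suc d))

asc : ℕ → ℕ → List ℕ
asc i d = map (λ t → i + suc t) (upTo d)

-- v is of one of the four forms of the statement
-- (the ranges make every letter one of s_1,…,s_{n-1})
GoodForm : ∀ {n} → ℕ → (Fin n → Fin n) → Set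
GoodForm {n} i v =
    (v ≗ wordProd (i ∷ []))
  ⊎ (∃[ d⁻ ] (0 < d⁻ × d⁻ < i × v ≗ wordProd (desc i d⁻)))
  ⊎ (∃[ d⁺ ] (0 < d⁺ × i + d⁺ < n × v ≗ wordProd (i ∷ asc i d⁺)))
  ⊎ (∃[ d⁻ ] ∃[ d⁺ ] (0 < d⁻ × d⁻ < i × 0 < d⁺ × i + d⁺ < n ×
        v ≗ wordProd (desc i d⁻ ++ asc i d⁺)))
  where open import Data.Sum using (_⊎_)

-- refinement R compatible with I (|I| = i): I = {j_1,…,j_i}
Compatible : ∀ {n} → ℕ → Subset n → Permutation′ n → Set
Compatible i I R = ∀ j → (j ∈ I) ⇔ (∃[ k ] (toℕ k < i × R ⟨$⟩ʳ k ≡ j))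

{-# OPTIONS --safe #-}
module Submission where

-- Let V = w w₀ and split the positions into the blocks [0, i) and [i, n). A word for V containing
-- s_i once shows that V moves exactly one position out of each block. While w⁻¹ has an ascent
-- w⁻¹(p) < w⁻¹(p + 1) at adjacent positions of one block, replace the refinement R by R ∘ s_{p+1}:
-- the rows of g are permuted by s_{p+1}, and b₁ ẇ (b₁ ∈ B) can be rewritten as b₁′ (s_{p+1} w)˙ u with
-- b₁′, u ∈ B, so the relative position becomes s_{p+1} w. Since s_{p+1} preserves the blocks, the
-- refinement stays compatible with I and V still moves one position out of each block, while
-- Σ x · w⁻¹(x) strictly drops. When no ascent is left, V⁻¹ = w₀ w⁻¹ is increasing on each block,
-- and an increasing map omitting a single value is forced: V = s_i s_{i−1} ⋯ s_{i−δ⁻} s_{i+1} ⋯ s_{i+δ⁺}.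

open import Defs
open import Level using (Level)
open import Algebra.Bundles using (CommutativeMonoid)
import Algebra.Properties.CommutativeMonoid.Sum as CommutativeMonoidSum
import Algebra.Properties.Semiring.Sum as SemiringSum
import Algebra.Solver.CommutativeMonoid as CommutativeMonoidSolver
import Algebra.Properties.Group as GroupProperties
import Algebra.Properties.Ring as RingProperties
open import Data.Bool using (true; false; T)
open import Data.Empty using (⊥-elim)
open import Data.Nat as Nat
  using (ℕ; zero; suc; pred; >-nonZero; _≤′_; ≤′-refl; ≤′-step; _≤_; _<_; z≤n; s≤s; z<s; _≡ᵇ_; _<?_; _≟_)
import Data.Nat.Properties as ℕₚ
open import Data.Nat.Tactic.RingSolver using (solve-∀)
open import Algebra.Properties.CommutativeSemigroup ℕₚ.+-commutativeSemigroup using (xy∙z≈xz∙y)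
open import Data.Fin as Fin using (Fin; toℕ; fromℕ<; punchIn; punchOut)
import Data.Fin.Induction as FinInduction
open import Induction.WellFounded using (Acc; acc)
open import Data.Fin.Subset using (Subset; ∣_∣)
open import Data.Fin.Properties
  using (any?; opposite-prop; opposite-involutive; toℕ-injective; toℕ<n; toℕ-fromℕ<; fromℕ<-toℕ;
         punchInᵢ≢i; punchIn-injective; punchIn-punchOut)
open import Data.Fin.Permutation as Perm using (Permutation′; permutation; _⟨$⟩ʳ_; _⟨$⟩ˡ_; inverseˡ; inverseʳ; _∘ₚ_)
open import Data.List using (List; []; _∷_; _++_; reverse; map; upTo; applyUpTo)
open import Data.List.Properties using (unfold-reverse; map-upTo; map-cong; ++-identityʳ)
open import Data.List.Relation.Unary.All as All using (All; []; _∷_)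
import Data.List.Relation.Unary.All.Properties as Allₚ
open import Data.Product using (∃-syntax; _×_; _,_; proj₁; proj₂)
open import Data.Sum using (inj₁; inj₂)
open import Function using (_∘_; id; flip)
open import Relation.Binary.PropositionalEquality
  using (_≡_; _≢_; refl; sym; trans; cong; cong₂; subst; subst₂; module ≡-Reasoning)
open import Relation.Nullary using (¬_; Dec; yes; no)
open import Relation.Nullary.Decidable using (_×-dec_; ¬?)
open import Function.Bundles using (mk⇔; Equivalence)
open import Relation.Binary.Definitions using (Tri; tri<; tri≈; tri>)
open import Relation.Binary.Bundles using (Setoid)
import Relation.Binary.Reasoning.Setoid as SetoidReasoning

module Transpositions where
  open ℕₚ

  data SwapView (a m : ℕ) : ℕ → Set where
    lower : m ≡ a → SwapView a m (suc a)
    upper : m ≡ suc a → SwapView a m a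
    other : m ≢ a → m ≢ suc a → SwapView a m m

  swapView : ∀ a m → SwapView a m (swapℕ (suc a) m)
  swapView a m with m ≡ᵇ a in m≡ᵇa
  ... | true = lower (≡ᵇ⇒≡ m a (subst T (sym m≡ᵇa) _))
  ... | false with m ≡ᵇ suc a in m≡ᵇ1+a
  ...   | true  = upper (≡ᵇ⇒≡ m (suc a) (subst T (sym m≡ᵇ1+a) _))
  ...   | false = other (λ eq → subst T m≡ᵇa (≡⇒≡ᵇ m a eq))
                        (λ eq → subst T m≡ᵇ1+a (≡⇒≡ᵇ m (suc a) eq))

  swapℕ-zero : ∀ m → swapℕ 0 m ≡ m
  swapℕ-zero zero    = refl
  swapℕ-zero (suc m) = refl

  swapℕ-lower : ∀ a → swapℕ (suc a) a ≡ suc a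
  swapℕ-lower a with swapℕ (suc a) a | swapView a a
  ... | _ | lower _     = refl
  ... | _ | upper a≡1+a = ⊥-elim (1+n≢n (sym a≡1+a))
  ... | _ | other a≢a _ = ⊥-elim (a≢a refl)

  swapℕ-upper : ∀ a → swapℕ (suc a) (suc a) ≡ a
  swapℕ-upper a with swapℕ (suc a) (suc a) | swapView a (suc a)
  ... | _ | lower 1+a≡a   = ⊥-elim (1+n≢n 1+a≡a)
  ... | _ | upper _       = refl
  ... | _ | other _ ne    = ⊥-elim (ne refl)

  swapℕ-other : ∀ a {m} → m ≢ a → m ≢ suc a → swapℕ (suc a) m ≡ m
  swapℕ-other a {m} m≢a m≢1+a with swapℕ (suc a) m | swapView a m
  ... | _ | lower m≡a   = ⊥-elim (m≢a m≡a)
  ... | _ | upper m≡1+a = ⊥-elim (m≢1+a m≡1+a)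
  ... | _ | other _ _   = refl

  swapℕ-below : ∀ a {m} → m < a → swapℕ (suc a) m ≡ m
  swapℕ-below a m<a = swapℕ-other a (<⇒≢ m<a) (<⇒≢ (<-trans m<a (n<1+n a)))

  swapℕ-above : ∀ a {m} → suc a < m → swapℕ (suc a) m ≡ m
  swapℕ-above a 1+a<m = swapℕ-other a (<⇒≢ (<-trans (n<1+n a) 1+a<m) ∘ sym) (<⇒≢ 1+a<m ∘ sym)

  swapℕ-involutive : ∀ j m → swapℕ j (swapℕ j m) ≡ m
  swapℕ-involutive zero    m = trans (swapℕ-zero (swapℕ 0 m)) (swapℕ-zero m)
  swapℕ-involutive (suc a) m with swapℕ (suc a) m | swapView a m
  ... | _ | lower refl = swapℕ-upper a
  ... | _ | upper refl = swapℕ-lower a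
  ... | _ | other m≢a m≢1+a = swapℕ-other a m≢a m≢1+a

  swapℕ-preserves-< : ∀ {i} j {m} → j ≢ i → m < i → swapℕ j m < i
  swapℕ-preserves-< zero {m} _ m<i = subst (_< _) (sym (swapℕ-zero m)) m<i
  swapℕ-preserves-< {i} (suc a) {m} 1+a≢i m<i with swapℕ (suc a) m | swapView a m
  ... | _ | lower refl = ≤∧≢⇒< m<i 1+a≢i
  ... | _ | upper refl = <-trans (n<1+n a) m<i
  ... | _ | other _ _  = m<i

  swapℕ-preserves-≥ : ∀ {i} j {m} → j ≢ i → i ≤ m → i ≤ swapℕ j m
  swapℕ-preserves-≥ {i} j {m} j≢i i≤m with swapℕ j m <? i
  ... | no  ≮i = ≮⇒≥ ≮i
  ... | yes <i = ⊥-elim (<⇒≱ (subst (_< i) (swapℕ-involutive j m) (swapℕ-preserves-< j j≢i <i)) i≤m)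

  swapℕ-preserves-order : ∀ a {l k} → l < k → ¬ (l ≡ a × k ≡ suc a) →
                          swapℕ (suc a) l < swapℕ (suc a) k
  swapℕ-preserves-order a {l} {k} l<k not-ab = go (swapView a l) (swapView a k)
    where
    go : ∀ {l′ k′} → SwapView a l l′ → SwapView a k k′ → l′ < k′
    go (lower refl) (lower refl)        = ⊥-elim (<-irrefl refl l<k)
    go (lower refl) (upper refl)        = ⊥-elim (not-ab (refl , refl))
    go (lower refl) (other _ k≢1+a)     = ≤∧≢⇒< l<k (k≢1+a ∘ sym)
    go (upper refl) (lower refl)        = ⊥-elim (<-asym l<k (n<1+n a))
    go (upper refl) (upper refl)        = ⊥-elim (<-irrefl refl l<k)
    go (upper refl) (other _ _)         = <-trans (n<1+n a) l<k
    go (other _ _)  (lower refl)        = <-trans l<k (n<1+n a)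
    go (other l≢a _) (upper refl)       = ≤∧≢⇒< (≤-pred l<k) l≢a
    go (other _ _)  (other _ _)         = l<k

  toℕ-s : ∀ {n} j (k : Fin n) → j < n → toℕ (s j k) ≡ swapℕ j (toℕ k)
  toℕ-s {n} j k j<n with swapℕ j (toℕ k) <? n
  ... | yes lt = toℕ-fromℕ< lt
  ... | no ≮n  = ⊥-elim (≮n (swapℕ-preserves-< j (<⇒≢ j<n) (toℕ<n k)))

  s-involutive : ∀ {n} j (k : Fin n) → j < n → s j (s j k) ≡ k
  s-involutive j k j<n = toℕ-injective (begin
    toℕ (s j (s j k))        ≡⟨ toℕ-s j (s j k) j<n ⟩
    swapℕ j (toℕ (s j k))    ≡⟨ cong (swapℕ j) (toℕ-s j k j<n) ⟩
    swapℕ j (swapℕ j (toℕ k)) ≡⟨ swapℕ-involutive j (toℕ k) ⟩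
    toℕ k                    ∎)
    where open ≡-Reasoning

  s-preserves-< : ∀ {n i} j (k : Fin n) → j < n → j ≢ i → toℕ k < i → toℕ (s j k) < i
  s-preserves-< j k j<n j≢i k<i =
    subst (_< _) (sym (toℕ-s j k j<n)) (swapℕ-preserves-< j j≢i k<i)

  s-preserves-≥ : ∀ {n i} j (k : Fin n) → j < n → j ≢ i → i ≤ toℕ k → i ≤ toℕ (s j k)
  s-preserves-≥ j k j<n j≢i i≤k =
    subst (_ ≤_) (sym (toℕ-s j k j<n)) (swapℕ-preserves-≥ j j≢i i≤k)

module Words where
  open ℕₚ
  open Transpositions

  AvoidsLetter : ℕ → ℕ → List ℕ → Set
  AvoidsLetter n i = All (λ j → j < n × j ≢ i)

  wordProd-++ : ∀ {n} xs ys (k : Fin n) → wordProd (xs ++ ys) k ≡ wordProd xs (wordProd ys k)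
  wordProd-++ []       ys k = refl
  wordProd-++ (x ∷ xs) ys k = cong (s x) (wordProd-++ xs ys k)

  wordProd-reverseʳ : ∀ {n} ws (k : Fin n) → All (_< n) ws →
                      wordProd ws (wordProd (reverse ws) k) ≡ k
  wordProd-reverseʳ []       k []           = refl
  wordProd-reverseʳ (j ∷ ws) k (j<n ∷ ws<n) = begin
    s j (wordProd ws (wordProd (reverse (j ∷ ws)) k))
      ≡⟨ cong (λ xs → s j (wordProd ws (wordProd xs k))) (unfold-reverse j ws) ⟩
    s j (wordProd ws (wordProd (reverse ws ++ j ∷ []) k))
      ≡⟨ cong (s j ∘ wordProd ws) (wordProd-++ (reverse ws) (j ∷ []) k) ⟩
    s j (wordProd ws (wordProd (reverse ws) (s j k)))
      ≡⟨ cong (s j) (wordProd-reverseʳ ws (s j k) ws<n) ⟩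
    s j (s j k)
      ≡⟨ s-involutive j k j<n ⟩
    k ∎
    where open ≡-Reasoning

  wordProd-reverseˡ : ∀ {n} ws (k : Fin n) → All (_< n) ws →
                      wordProd (reverse ws) (wordProd ws k) ≡ k
  wordProd-reverseˡ []       k []           = refl
  wordProd-reverseˡ (j ∷ ws) k (j<n ∷ ws<n) = begin
    wordProd (reverse (j ∷ ws)) (s j (wordProd ws k))
      ≡⟨ cong (λ xs → wordProd xs (s j (wordProd ws k))) (unfold-reverse j ws) ⟩
    wordProd (reverse ws ++ j ∷ []) (s j (wordProd ws k))
      ≡⟨ wordProd-++ (reverse ws) (j ∷ []) _ ⟩
    wordProd (reverse ws) (s j (s j (wordProd ws k)))
      ≡⟨ cong (wordProd (reverse ws)) (s-involutive j _ j<n) ⟩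
    wordProd (reverse ws) (wordProd ws k)
      ≡⟨ wordProd-reverseˡ ws k ws<n ⟩
    k ∎
    where open ≡-Reasoning

  wordProdℕ : List ℕ → ℕ → ℕ
  wordProdℕ []       = id
  wordProdℕ (j ∷ ws) = swapℕ j ∘ wordProdℕ ws

  toℕ-wordProd : ∀ {n} ws (k : Fin n) → All (_< n) ws → toℕ (wordProd ws k) ≡ wordProdℕ ws (toℕ k)
  toℕ-wordProd []       k []           = refl
  toℕ-wordProd (j ∷ ws) k (j<n ∷ ws<n) =
    trans (toℕ-s j (wordProd ws k) j<n) (cong (swapℕ j) (toℕ-wordProd ws k ws<n))

  PreservesBlocks : ∀ {n} → ℕ → (Fin n → Fin n) → Set
  PreservesBlocks i σ = (∀ k → toℕ k < i → toℕ (σ k) < i) × (∀ k → i ≤ toℕ k → i ≤ toℕ (σ k))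

  s-preservesBlocks : ∀ {n i} j → j < n → j ≢ i → PreservesBlocks {n} i (s j)
  s-preservesBlocks j j<n j≢i = (λ k → s-preserves-< j k j<n j≢i) , (λ k → s-preserves-≥ j k j<n j≢i)

  preservesBlocks-∘ : ∀ {n i} {σ ρ : Fin n → Fin n} →
                      PreservesBlocks i σ → PreservesBlocks i ρ → PreservesBlocks i (σ ∘ ρ)
  preservesBlocks-∘ (σ< , σ≥) (ρ< , ρ≥) = (λ k → σ< _ ∘ ρ< k) , (λ k → σ≥ _ ∘ ρ≥ k)

  preservesBlocks-inverse : ∀ {n i} {σ σ⁻¹ : Fin n → Fin n} → (∀ k → σ (σ⁻¹ k) ≡ k) →
                            PreservesBlocks i σ → PreservesBlocks i σ⁻¹
  preservesBlocks-inverse {i = i} {σ} {σ⁻¹} inverse (σ< , σ≥) = σ⁻¹< , σ⁻¹≥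
    where
    σ⁻¹< : ∀ k → toℕ k < i → toℕ (σ⁻¹ k) < i
    σ⁻¹< k k<i with toℕ (σ⁻¹ k) <? i
    ... | yes <i = <i
    ... | no  ≮i = ⊥-elim (<⇒≱ k<i (subst (λ x → i ≤ toℕ x) (inverse k) (σ≥ _ (≮⇒≥ ≮i))))
    σ⁻¹≥ : ∀ k → i ≤ toℕ k → i ≤ toℕ (σ⁻¹ k)
    σ⁻¹≥ k i≤k with toℕ (σ⁻¹ k) <? i
    ... | no  ≮i = ≮⇒≥ ≮i
    ... | yes <i = ⊥-elim (<⇒≱ (subst (λ x → toℕ x < i) (inverse k) (σ< _ <i)) i≤k)

  wordProd-preservesBlocks : ∀ {n i} ws → AvoidsLetter n i ws → PreservesBlocks {n} i (wordProd ws)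
  wordProd-preservesBlocks []       []                     = (λ _ k<i → k<i) , (λ _ i≤k → i≤k)
  wordProd-preservesBlocks (j ∷ ws) ((j<n , j≢i) ∷ avoids) =
    preservesBlocks-∘ (s-preservesBlocks j j<n j≢i) (wordProd-preservesBlocks ws avoids)

  validWord⇒letters< : ∀ {n} ws → ValidWord n ws → All (_< n) ws
  validWord⇒letters< {n} _ = All.map (λ { {j} (_ , j+1≤n) → subst (_≤ n) (+-comm j 1) j+1≤n })

  ≡ᵇ-false⇒≢ : ∀ {j i} → (j ≡ᵇ i) ≡ false → j ≢ i
  ≡ᵇ-false⇒≢ {j} {i} j≢ᵇi j≡i = subst T j≢ᵇi (≡⇒≡ᵇ j i j≡i)

  count-zero⇒avoids : ∀ i ws → count i ws ≡ 0 → All (_≢ i) ws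
  count-zero⇒avoids i []       _        = []
  count-zero⇒avoids i (j ∷ ws) count≡0 with j ≡ᵇ i in j≡ᵇi
  ... | false = ≡ᵇ-false⇒≢ j≡ᵇi ∷ count-zero⇒avoids i ws count≡0

  split-single-occurrence : ∀ i ws → count i ws ≡ 1 →
    ∃[ xs ] ∃[ ys ] (ws ≡ xs ++ i ∷ ys × All (_≢ i) xs × All (_≢ i) ys)
  split-single-occurrence i (j ∷ ws) count≡1 with j ≡ᵇ i in j≡ᵇi
  ... | true  = [] , ws , cong (_∷ ws) (≡ᵇ⇒≡ j i (subst T (sym j≡ᵇi) _)) , [] ,
                count-zero⇒avoids i ws (suc-injective count≡1)
  ... | false with split-single-occurrence i ws count≡1
  ...   | xs , ys , ws≡ , xs-avoid , ys-avoid = j ∷ xs , ys , cong (j ∷_) ws≡ , ≡ᵇ-false⇒≢ j≡ᵇi ∷ xs-avoid , ys-avoid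

module SingleCrossings where
  open ℕₚ
  open Transpositions
  open Words

  record SingleCrossing {n} (i : ℕ) (V : Fin n → Fin n) : Set where
    field
      up down      : Fin n
      up<i         : toℕ up < i
      i≤down       : i ≤ toℕ down
      i≤V-up       : i ≤ toℕ (V up)
      V-down<i     : toℕ (V down) < i
      lower-stable : ∀ k → k ≢ up → toℕ k < i → toℕ (V k) < i
      upper-stable : ∀ k → k ≢ down → i ≤ toℕ k → i ≤ toℕ (V k)

  module _ {n i : ℕ} where

    singleCrossing-resp-≗ : {V W : Fin n → Fin n} → V ≗ W → SingleCrossing i V → SingleCrossing i W
    singleCrossing-resp-≗ V≗W c = record
      { up = up ; down = down ; up<i = up<i ; i≤down = i≤down
      ; i≤V-up       = subst (λ x → i ≤ toℕ x) (V≗W up) i≤V-up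
      ; V-down<i     = subst (λ x → toℕ x < i) (V≗W down) V-down<i
      ; lower-stable = λ k k≢up k<i → subst (λ x → toℕ x < i) (V≗W k) (lower-stable k k≢up k<i)
      ; upper-stable = λ k k≢down i≤k → subst (λ x → i ≤ toℕ x) (V≗W k) (upper-stable k k≢down i≤k)
      }
      where open SingleCrossing c

    singleCrossing-∘ˡ : {σ V : Fin n → Fin n} →
                        PreservesBlocks i σ → SingleCrossing i V → SingleCrossing i (σ ∘ V)
    singleCrossing-∘ˡ (σ< , σ≥) c = record
      { up = up ; down = down ; up<i = up<i ; i≤down = i≤down
      ; i≤V-up       = σ≥ _ i≤V-up
      ; V-down<i     = σ< _ V-down<i
      ; lower-stable = λ k k≢up k<i → σ< _ (lower-stable k k≢up k<i)
      ; upper-stable = λ k k≢down i≤k → σ≥ _ (upper-stable k k≢down i≤k)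
      }
      where open SingleCrossing c

    singleCrossing-∘ʳ : {σ σ⁻¹ V : Fin n → Fin n} →
                        (∀ k → σ (σ⁻¹ k) ≡ k) → (∀ k → σ⁻¹ (σ k) ≡ k) →
                        PreservesBlocks i σ → SingleCrossing i V → SingleCrossing i (V ∘ σ)
    singleCrossing-∘ʳ {σ} {σ⁻¹} {V} σσ⁻¹ σ⁻¹σ σ-blocks@(σ< , σ≥) c = record
      { up = σ⁻¹ up ; down = σ⁻¹ down
      ; up<i         = σ⁻¹< up up<i
      ; i≤down       = σ⁻¹≥ down i≤down
      ; i≤V-up       = subst (λ x → i ≤ toℕ (V x)) (sym (σσ⁻¹ up)) i≤V-up
      ; V-down<i     = subst (λ x → toℕ (V x) < i) (sym (σσ⁻¹ down)) V-down<i
      ; lower-stable = λ k k≢ k<i → lower-stable (σ k) (k≢ ∘ moved k) (σ< k k<i)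
      ; upper-stable = λ k k≢ i≤k → upper-stable (σ k) (k≢ ∘ moved k) (σ≥ k i≤k)
      }
      where
      open SingleCrossing c
      σ⁻¹< : ∀ k → toℕ k < i → toℕ (σ⁻¹ k) < i
      σ⁻¹< = proj₁ (preservesBlocks-inverse σσ⁻¹ σ-blocks)
      σ⁻¹≥ : ∀ k → i ≤ toℕ k → i ≤ toℕ (σ⁻¹ k)
      σ⁻¹≥ = proj₂ (preservesBlocks-inverse σσ⁻¹ σ-blocks)
      moved : ∀ k {x} → σ k ≡ x → k ≡ σ⁻¹ x
      moved k refl = sym (σ⁻¹σ k)

  s-singleCrossing : ∀ {n} a → suc a < n → SingleCrossing (suc a) (s {n} (suc a))
  s-singleCrossing {n} a 1+a<n = record
    { up = fromℕ< a<n ; down = fromℕ< 1+a<n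
    ; up<i         = subst (_< suc a) (sym (toℕ-fromℕ< a<n)) (n<1+n a)
    ; i≤down       = subst (suc a ≤_) (sym (toℕ-fromℕ< 1+a<n)) ≤-refl
    ; i≤V-up       = subst (suc a ≤_) (sym (trans (toℕ-s (suc a) _ 1+a<n)
                       (trans (cong (swapℕ (suc a)) (toℕ-fromℕ< a<n)) (swapℕ-lower a)))) ≤-refl
    ; V-down<i     = subst (_< suc a) (sym (trans (toℕ-s (suc a) _ 1+a<n)
                       (trans (cong (swapℕ (suc a)) (toℕ-fromℕ< 1+a<n)) (swapℕ-upper a)))) (n<1+n a)
    ; lower-stable = λ k k≢up k<i → subst (_< suc a) (sym (fixed k (k≢up ∘ toℕ-up) (<⇒≢ k<i))) k<i
    ; upper-stable = λ k k≢down i≤k →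
        subst (suc a ≤_) (sym (fixed k (λ k≡a → <⇒≱ (n<1+n a) (subst (suc a ≤_) k≡a i≤k)) (k≢down ∘ toℕ-down))) i≤k
    }
    where
    a<n : a < n
    a<n = <-trans (n<1+n a) 1+a<n
    toℕ-up : ∀ {k} → toℕ k ≡ a → k ≡ fromℕ< a<n
    toℕ-up k≡a = toℕ-injective (trans k≡a (sym (toℕ-fromℕ< a<n)))
    toℕ-down : ∀ {k} → toℕ k ≡ suc a → k ≡ fromℕ< 1+a<n
    toℕ-down k≡1+a = toℕ-injective (trans k≡1+a (sym (toℕ-fromℕ< 1+a<n)))
    fixed : ∀ k → toℕ k ≢ a → toℕ k ≢ suc a → toℕ (s (suc a) k) ≡ toℕ k
    fixed k k≢a k≢1+a = trans (toℕ-s (suc a) k 1+a<n) (swapℕ-other a k≢a k≢1+a)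

  wordProd-singleCrossing : ∀ {n} a → suc a < n → ∀ ws → ValidWord n ws → count (suc a) ws ≡ 1 →
                            SingleCrossing (suc a) (wordProd {n} ws)
  wordProd-singleCrossing {n} a 1+a<n ws valid count≡1 with split-single-occurrence (suc a) ws count≡1
  ... | xs , ys , refl , xs-avoid , ys-avoid =
    singleCrossing-resp-≗ (λ k → sym (wordProd-++ xs (suc a ∷ ys) k))
      (singleCrossing-∘ˡ (wordProd-preservesBlocks xs (avoidsLetter xs xs<n xs-avoid))
        (singleCrossing-∘ʳ (λ k → wordProd-reverseʳ ys k ys<n) (λ k → wordProd-reverseˡ ys k ys<n)
          (wordProd-preservesBlocks ys (avoidsLetter ys ys<n ys-avoid))
          (s-singleCrossing a 1+a<n)))
    where
    letters<n : All (_< n) (xs ++ suc a ∷ ys)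
    letters<n = validWord⇒letters< (xs ++ suc a ∷ ys) valid
    xs<n : All (_< n) xs
    xs<n = Allₚ.++⁻ˡ xs letters<n
    ys<n : All (_< n) ys
    ys<n = Allₚ.++⁻ʳ (suc a ∷ []) (Allₚ.++⁻ʳ xs letters<n)
    avoidsLetter : ∀ zs → All (_< n) zs → All (_≢ suc a) zs → AvoidsLetter n (suc a) zs
    avoidsLetter zs zs<n zs-avoid = All.zip (zs<n , zs-avoid)

module IncreasingMaps where
  open ℕₚ
  open Nat using (_+_)

  module _ (g : ℕ → ℕ) {lo hi : ℕ} (increasing : ∀ t → lo ≤ t → suc t < hi → g t < g (suc t)) where

    -- g y − g x ≥ y − x, stated without truncated subtraction
    increasing-expands : ∀ {x y} → lo ≤ x → x ≤ y → y < hi → g x + y ≤ g y + x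
    increasing-expands {x} lo≤x x≤y = go (≤⇒≤′ x≤y)
      where
      go : ∀ {y} → x ≤′ y → y < hi → g x + y ≤ g y + x
      go ≤′-refl _ = ≤-refl
      go (≤′-step {y} x≤′y) 1+y<hi = begin
        g x + suc y   ≡⟨ +-suc (g x) y ⟩
        suc (g x + y) ≤⟨ s≤s (go x≤′y (<-trans (n<1+n y) 1+y<hi)) ⟩
        suc (g y + x) ≤⟨ +-monoˡ-≤ x (increasing y (≤-trans lo≤x (≤′⇒≤ x≤′y)) 1+y<hi) ⟩
        g (suc y) + x ∎
        where open ≤-Reasoning

    strictly-increasing : ∀ {x y} → lo ≤ x → x < y → y < hi → g x < g y
    strictly-increasing {x} {y} lo≤x x<y y<hi = +-cancelʳ-≤ x (suc (g x)) (g y) (begin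
      suc (g x + x) ≡⟨ +-suc (g x) x ⟨
      g x + suc x   ≤⟨ +-monoʳ-≤ (g x) x<y ⟩
      g x + y       ≤⟨ increasing-expands lo≤x (<⇒≤ x<y) y<hi ⟩
      g y + x       ∎)
      where open ≤-Reasoning

  private
    +-exchange-suc : ∀ b x y → b + suc x + y ≡ b + suc y + x
    +-exchange-suc = solve-∀

    suc-+-exchange : ∀ b x y → suc (b + x) + y ≡ b + suc y + x
    suc-+-exchange = solve-∀

  -- An increasing map of [0, L) into [b, b + L] is determined by the one value b + c it omits.
  module Gap (g : ℕ → ℕ) (b L c : ℕ) (c≤L : c ≤ L)
    (increasing : ∀ t → suc t < L → g t < g (suc t))
    (bounded : ∀ t → t < L → b ≤ g t × g t ≤ b + L)
    (avoids : ∀ t → t < L → g t ≢ b + c) where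

    expands : ∀ {x y} → x ≤ y → y < L → g x + y ≤ g y + x
    expands = increasing-expands g (λ t _ → increasing t) z≤n

    lower-bound : ∀ t → t < L → b + t ≤ g t
    lower-bound t t<L = begin
      b + t     ≤⟨ +-monoˡ-≤ t (proj₁ (bounded 0 (≤-<-trans z≤n t<L))) ⟩
      g 0 + t   ≤⟨ expands z≤n t<L ⟩
      g t + 0   ≡⟨ +-identityʳ (g t) ⟩
      g t       ∎
      where open ≤-Reasoning

    upper-bound : ∀ t → t < L → g t ≤ b + suc t
    upper-bound t t<L = +-cancelʳ-≤ top (g t) (b + suc t) (begin
      g t + top         ≤⟨ expands (≤-pred (subst (t <_) (sym 1+top≡L) t<L)) top<L ⟩
      g top + t         ≤⟨ +-monoˡ-≤ t (subst (λ l → g top ≤ b + l) (sym 1+top≡L) (proj₂ (bounded top top<L))) ⟩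
      b + suc top + t   ≡⟨ +-exchange-suc b top t ⟩
      b + suc t + top   ∎)
      where
      open ≤-Reasoning
      top : ℕ
      top = pred L
      1+top≡L : suc top ≡ L
      1+top≡L = suc-pred L {{>-nonZero (m<n⇒0<n t<L)}}
      top<L : top < L
      top<L = subst (top <_) 1+top≡L ≤-refl

    below-gap : ∀ t → t < c → g t ≡ b + t
    below-gap t t<c = ≤-antisym (+-cancelʳ-≤ C (g t) (b + t) (begin
      g t + C   ≤⟨ expands (≤-pred (subst (t <_) (sym 1+C≡c) t<c)) C<L ⟩
      g C + t   ≤⟨ +-monoˡ-≤ t gC≤b+C ⟩
      b + C + t ≡⟨ xy∙z≈xz∙y b C t ⟩
      b + t + C ∎)) (lower-bound t (<-≤-trans t<c c≤L))
      where
      open ≤-Reasoning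
      C : ℕ
      C = pred c
      1+C≡c : suc C ≡ c
      1+C≡c = suc-pred c {{>-nonZero (m<n⇒0<n t<c)}}
      C<L : C < L
      C<L = subst (_≤ L) (sym 1+C≡c) c≤L
      gC≤b+C : g C ≤ b + C
      gC≤b+C = ≤-pred (subst (g C <_) (+-suc b C)
                 (≤∧≢⇒< (upper-bound C C<L) (λ eq → avoids C C<L (trans eq (cong (b +_) 1+C≡c)))))

    above-gap : ∀ t → c ≤ t → t < L → g t ≡ b + suc t
    above-gap t c≤t t<L = ≤-antisym (upper-bound t t<L) (+-cancelʳ-≤ c (b + suc t) (g t) (begin
      b + suc t + c   ≡⟨ suc-+-exchange b c t ⟨
      suc (b + c) + t ≤⟨ +-monoˡ-≤ t b+c<gc ⟩
      g c + t         ≤⟨ expands c≤t t<L ⟩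
      g t + c         ∎))
      where
      open ≤-Reasoning
      c<L : c < L
      c<L = ≤-<-trans c≤t t<L
      b+c<gc : b + c < g c
      b+c<gc = ≤∧≢⇒< (lower-bound c c<L) (λ eq → avoids c c<L (sym eq))

module Cycles where
  open ℕₚ
  open Nat using (_+_; _∸_)
  open Transpositions
  open Words

  record CyclesDown (lo hi : ℕ) (f : ℕ → ℕ) : Set where
    field
      at-lo   : f lo ≡ hi
      between : ∀ {m} → lo < m → m ≤ hi → f m ≡ pred m
      below   : ∀ {m} → m < lo → f m ≡ m
      above   : ∀ {m} → hi < m → f m ≡ m

  record CyclesUp (lo hi : ℕ) (f : ℕ → ℕ) : Set where
    field
      at-hi   : f hi ≡ lo
      between : ∀ {m} → lo ≤ m → m < hi → f m ≡ suc m
      below   : ∀ {m} → m < lo → f m ≡ m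
      above   : ∀ {m} → hi < m → f m ≡ m

  desc-suc : ∀ j d → desc (suc j) (suc d) ≡ suc j ∷ desc j d
  desc-suc j d = trans (map-upTo (suc j ∸_) (suc (suc d))) (cong (suc j ∷_) (sym (map-upTo (j ∸_) (suc d))))

  asc-suc : ∀ i e → asc i (suc e) ≡ suc i ∷ asc (suc i) e
  asc-suc i e = trans (map-upTo (λ t → i + suc t) (suc e)) (cong₂ _∷_ (+-comm i 1) (begin
    applyUpTo (λ t → i + suc (suc t)) e   ≡⟨ map-upTo (λ t → i + suc (suc t)) e ⟨
    map (λ t → i + suc (suc t)) (upTo e)  ≡⟨ map-cong (λ t → +-suc i (suc t)) (upTo e) ⟩
    asc (suc i) e                         ∎))
    where open ≡-Reasoning

  desc-cycle : ∀ j d → d ≤ j → CyclesDown (j ∸ d) (suc j) (wordProdℕ (desc (suc j) d))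
  desc-cycle j zero _ = record
    { at-lo   = swapℕ-lower j
    ; between = between′
    ; below   = swapℕ-below j
    ; above   = swapℕ-above j
    }
    where
    between′ : ∀ {m} → j < m → m ≤ suc j → swapℕ (suc j) m ≡ pred m
    between′ j<m m≤1+j with ≤-antisym m≤1+j j<m
    ... | refl = swapℕ-upper j
  desc-cycle (suc j) (suc d) (s≤s d≤j) =
    subst (CyclesDown (j ∸ d) (suc (suc j)) ∘ wordProdℕ) (sym (desc-suc (suc j) d)) (record
    { at-lo   = trans (cong (swapℕ (suc (suc j))) at-lo) (swapℕ-lower (suc j))
    ; between = between′
    ; below   = λ m<lo → trans (cong (swapℕ (suc (suc j))) (below m<lo))
                           (swapℕ-below (suc j) (<-≤-trans m<lo (≤-trans (m∸n≤m j d) (n≤1+n j))))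
    ; above   = λ 2+j<m → trans (cong (swapℕ (suc (suc j))) (above (<-trans (n<1+n _) 2+j<m)))
                            (swapℕ-above (suc j) 2+j<m)
    })
    where
    open CyclesDown (desc-cycle j d d≤j)
    between′ : ∀ {m} → j ∸ d < m → m ≤ suc (suc j) → swapℕ (suc (suc j)) (wordProdℕ (desc (suc j) d) m) ≡ pred m
    between′ {suc m} lo<m m<2+j with m ≟ suc j
    ... | yes refl   = trans (cong (swapℕ (suc (suc j))) (above (n<1+n (suc j)))) (swapℕ-upper (suc j))
    ... | no  m≢1+j = trans (cong (swapℕ (suc (suc j))) (between lo<m m<1+j)) (swapℕ-below (suc j) m<1+j)
      where
      m<1+j : m < suc j
      m<1+j = ≤∧≢⇒< (≤-pred m<2+j) m≢1+j

  asc-cycle : ∀ e i → CyclesUp i (i + e) (wordProdℕ (asc i e))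
  asc-cycle zero i = record
    { at-hi   = +-identityʳ i
    ; between = λ i≤m m<i+0 → ⊥-elim (<⇒≱ (subst (_ <_) (+-identityʳ i) m<i+0) i≤m)
    ; below   = λ _ → refl
    ; above   = λ _ → refl
    }
  asc-cycle (suc e) i =
    subst₂ (λ hi ws → CyclesUp i hi (wordProdℕ ws)) (sym (+-suc i e)) (sym (asc-suc i e)) (record
    { at-hi   = trans (cong (swapℕ (suc i)) at-hi) (swapℕ-upper i)
    ; between = between′
    ; below   = λ m<i → trans (cong (swapℕ (suc i)) (below (<-trans m<i (n<1+n i)))) (swapℕ-below i m<i)
    ; above   = λ hi<m → trans (cong (swapℕ (suc i)) (above hi<m))
                           (swapℕ-above i (≤-<-trans (s≤s (m≤m+n i e)) hi<m))
    })
    where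
    open CyclesUp (asc-cycle e (suc i))
    between′ : ∀ {m} → i ≤ m → m < suc (i + e) → swapℕ (suc i) (wordProdℕ (asc (suc i) e) m) ≡ suc m
    between′ {m} i≤m m<hi with i ≟ m
    ... | yes refl = trans (cong (swapℕ (suc i)) (below (n<1+n i))) (swapℕ-lower i)
    ... | no  i≢m  = trans (cong (swapℕ (suc i)) (between (≤∧≢⇒< i≤m i≢m) m<hi))
                       (swapℕ-above i (s≤s (≤∧≢⇒< i≤m i≢m)))

module SortedCrossings where
  open ℕₚ
  open Nat using (_+_; _∸_)
  open Words
  open SingleCrossings
  open IncreasingMaps
  open Cycles

  module Lifted (n i₁ up down : ℕ) (u v : ℕ → ℕ)
    (u<n : ∀ m → m < n → u m < n) (v<n : ∀ m → m < n → v m < n)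
    (u∘v : ∀ m → m < n → u (v m) ≡ m)
    (v∘u : ∀ m → m < n → v (u m) ≡ m)
    (i<n : suc i₁ < n) (up<i : up < suc i₁) (i≤down : suc i₁ ≤ down) (down<n : down < n)
    (i≤v-up : suc i₁ ≤ v up) (v-down<i : v down < suc i₁)
    (lower-stable : ∀ m → m < n → m < suc i₁ → m ≢ up → v m < suc i₁)
    (upper-stable : ∀ m → m < n → suc i₁ ≤ m → m ≢ down → suc i₁ ≤ v m)
    (sorted : ∀ m → suc m < n → suc m ≢ suc i₁ → u m < u (suc m)) where

    private
      i : ℕ
      i = suc i₁

    u-lower : ∀ m → m < i → m ≢ v down → u m < i
    u-lower m m<i m≢v-down with u m <? i
    ... | yes um<i = um<i
    ... | no  um≮i with u m ≟ down
    ...   | yes um≡down = ⊥-elim (m≢v-down (trans (sym (v∘u m (<-trans m<i i<n))) (cong v um≡down)))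
    ...   | no  um≢down = ⊥-elim (<⇒≱ m<i (subst (i ≤_) (v∘u m (<-trans m<i i<n))
                                   (upper-stable (u m) (u<n m (<-trans m<i i<n)) (≮⇒≥ um≮i) um≢down)))

    u-upper : ∀ m → i ≤ m → m < n → m ≢ v up → i ≤ u m
    u-upper m i≤m m<n m≢v-up with u m <? i
    ... | no  um≮i = ≮⇒≥ um≮i
    ... | yes um<i with u m ≟ up
    ...   | yes um≡up = ⊥-elim (m≢v-up (trans (sym (v∘u m m<n)) (cong v um≡up)))
    ...   | no  um≢up = ⊥-elim (<⇒≱ (subst (_< i) (v∘u m m<n) (lower-stable (u m) (u<n m m<n) um<i um≢up)) i≤m)

    u-not-up : ∀ m → m < i → u m ≢ up
    u-not-up m m<i um≡up = <⇒≱ m<i (subst (i ≤_) (trans (cong v (sym um≡up)) (v∘u m (<-trans m<i i<n))) i≤v-up)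

    u-not-down : ∀ m → i ≤ m → m < n → u m ≢ down
    u-not-down m i≤m m<n um≡down = <⇒≱ (subst (_< i) (trans (cong v (sym um≡down)) (v∘u m m<n)) v-down<i) i≤m

    v-down≡i₁ : v down ≡ i₁
    v-down≡i₁ with v down <? i₁
    ... | no  ≮i₁ = ≤-antisym (≤-pred v-down<i) (≮⇒≥ ≮i₁)
    ... | yes <i₁ = ⊥-elim (<⇒≱ (<-≤-trans (u-lower i₁ (n<1+n i₁) (<⇒≢ <i₁ ∘ sym)) i≤down) (<⇒≤ down<ui₁))
      where
      down<ui₁ : down < u i₁
      down<ui₁ = subst (_< u i₁) (u∘v down down<n)
                   (strictly-increasing u {0} {i} (λ t _ 1+t<i → sorted t (<-trans 1+t<i i<n) (<⇒≢ 1+t<i))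
                      z≤n <i₁ (n<1+n i₁))

    v-up≡i : v up ≡ i
    v-up≡i with i <? v up
    ... | no  ≮v-up = ≤-antisym (≮⇒≥ ≮v-up) i≤v-up
    ... | yes <v-up = ⊥-elim (<⇒≱ (<-trans ui<up up<i) (u-upper i ≤-refl i<n (<⇒≢ <v-up)))
      where
      ui<up : u i < up
      ui<up = subst (u i <_) (u∘v up (<-trans up<i i<n))
                (strictly-increasing u {i} {n} (λ t i≤t 1+t<n → sorted t 1+t<n (<⇒≢ (s≤s i≤t) ∘ sym))
                   ≤-refl <v-up (v<n up (<-trans up<i i<n)))

    u-i₁ : u i₁ ≡ down
    u-i₁ = trans (cong u (sym v-down≡i₁)) (u∘v down down<n)

    u-i : u i ≡ up
    u-i = trans (cong u (sym v-up≡i)) (u∘v up (<-trans up<i i<n))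

    private
      i₁<n : i₁ < n
      i₁<n = <-trans (n<1+n i₁) i<n

    module LowerBlock = Gap u 0 i₁ up (≤-pred up<i)
      (λ t 1+t<i₁ → sorted t (<-trans 1+t<i₁ i₁<n) (<⇒≢ (<-trans 1+t<i₁ (n<1+n i₁))))
      (λ t t<i₁ → z≤n , ≤-pred (u-lower t (<-trans t<i₁ (n<1+n i₁)) (<⇒≢ (subst (t <_) (sym v-down≡i₁) t<i₁))))
      (λ t t<i₁ → u-not-up t (<-trans t<i₁ (n<1+n i₁)))

    private
      L c : ℕ
      L = n ∸ suc i
      c = down ∸ i

      1+L+i≡n : suc L + i ≡ n
      1+L+i≡n = trans (sym (+-suc L i)) (m∸n+n≡m i<n)

      i+c≡down : i + c ≡ down
      i+c≡down = m+[n∸m]≡n i≤down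

      upper-index : ∀ {t} → t < L → suc t + i < n
      upper-index {t} t<L = subst (suc t + i <_) 1+L+i≡n (+-monoˡ-< i (s≤s t<L))

      c≤L : c ≤ L
      c≤L = ≤-pred (+-cancelʳ-< i c (suc L) (subst₂ _<_ (sym (trans (+-comm c i) i+c≡down)) (sym 1+L+i≡n) down<n))

    module UpperBlock = Gap (λ t → u (suc t + i)) i L c c≤L
      (λ t 1+t<L → sorted (suc t + i) (upper-index 1+t<L) (<⇒≢ (s≤s (m≤n+m i (suc t))) ∘ sym))
      (λ t t<L → u-upper (suc t + i) (m≤n+m i (suc t)) (upper-index t<L)
                   (λ eq → <⇒≢ (s≤s (m≤n+m i t)) (sym (trans eq v-up≡i)))
               , subst (u (suc t + i) ≤_) (+-comm L i)
                   (≤-pred (subst (u (suc t + i) <_) (sym 1+L+i≡n) (u<n _ (upper-index t<L)))))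
      (λ t t<L → u-not-down (suc t + i) (m≤n+m i (suc t)) (upper-index t<L) ∘ (λ eq → trans eq i+c≡down))

    u-shifted : ∀ x → i ≤ x → x < down → u (suc x) ≡ x
    u-shifted x i≤x x<down = begin
      u (suc x)     ≡⟨ cong (u ∘ suc) x≡t+i ⟨
      u (suc t + i) ≡⟨ UpperBlock.below-gap t t<c ⟩
      i + t         ≡⟨ +-comm i t ⟩
      t + i         ≡⟨ x≡t+i ⟩
      x             ∎
      where
      open ≡-Reasoning
      t : ℕ
      t = x ∸ i
      x≡t+i : t + i ≡ x
      x≡t+i = m∸n+n≡m i≤x
      t<c : t < c
      t<c = +-cancelʳ-< i t c (subst₂ _<_ (sym x≡t+i) (trans (sym i+c≡down) (+-comm i c)) x<down)

    u-fixed : ∀ x → down < x → x < n → u x ≡ x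
    u-fixed x down<x x<n = begin
      u x           ≡⟨ cong u x≡1+t+i ⟨
      u (suc t + i) ≡⟨ UpperBlock.above-gap t c≤t t<L ⟩
      i + suc t     ≡⟨ +-comm i (suc t) ⟩
      suc t + i     ≡⟨ x≡1+t+i ⟩
      x             ∎
      where
      open ≡-Reasoning
      t : ℕ
      t = x ∸ suc i
      x≡1+t+i : suc t + i ≡ x
      x≡1+t+i = trans (sym (+-suc t i)) (m∸n+n≡m (≤-<-trans i≤down down<x))
      t<L : t < L
      t<L = +-cancelʳ-< i t L (≤-pred (subst₂ _<_ (sym x≡1+t+i) (sym 1+L+i≡n) x<n))
      c≤t : c ≤ t
      c≤t = +-cancelʳ-≤ i c t (≤-pred (subst₂ _<_ (trans (sym i+c≡down) (+-comm i c)) (sym x≡1+t+i) down<x))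

    u-cycles : ∀ {D A} → CyclesDown up i D → CyclesUp i down A → ∀ x → x < n → u (D (A x)) ≡ x
    u-cycles {D} {A} D-cycle A-cycle x x<n with x <? i
    ... | yes x<i = trans (cong (u ∘ D) (A.below x<i)) (lower x<i (<-cmp x up))
      where
      module A = CyclesUp A-cycle
      module D = CyclesDown D-cycle
      lower : ∀ {x} → x < i → Tri (x < up) (x ≡ up) (up < x) → u (D x) ≡ x
      lower x<i (tri< x<up _ _) = trans (cong u (D.below x<up)) (LowerBlock.below-gap _ x<up)
      lower x<i (tri≈ _ refl _) = trans (cong u D.at-lo) u-i
      lower {suc x} x<i (tri> _ _ up<x) =
        trans (cong u (D.between up<x (<⇒≤ x<i))) (LowerBlock.above-gap x (≤-pred up<x) (≤-pred x<i))
    ... | no x≮i = upper (≮⇒≥ x≮i) (<-cmp x down)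
      where
      module A = CyclesUp A-cycle
      module D = CyclesDown D-cycle
      upper : i ≤ x → Tri (x < down) (x ≡ down) (down < x) → u (D (A x)) ≡ x
      upper i≤x (tri< x<down _ _) =
        trans (cong (u ∘ D) (A.between i≤x x<down)) (trans (cong u (D.above (s≤s i≤x))) (u-shifted x i≤x x<down))
      upper i≤x (tri≈ _ refl _) = trans (cong (u ∘ D) A.at-hi) (trans (cong u (D.between up<i ≤-refl)) u-i₁)
      upper i≤x (tri> _ _ down<x) =
        trans (cong (u ∘ D) (A.above down<x))
          (trans (cong u (D.above (≤-<-trans i≤down down<x))) (u-fixed x down<x x<n))

  liftℕ : ∀ {n} → (Fin n → Fin n) → ℕ → ℕ
  liftℕ {n} f m with m <? n
  ... | yes m<n = toℕ (f (fromℕ< m<n))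
  ... | no  _   = m

  liftℕ-fromℕ< : ∀ {n} (f : Fin n → Fin n) {m} (m<n : m < n) → liftℕ f m ≡ toℕ (f (fromℕ< m<n))
  liftℕ-fromℕ< {n} f {m} m<n with m <? n
  ... | yes _  = refl
  ... | no ≮n = ⊥-elim (≮n m<n)

  liftℕ-toℕ : ∀ {n} (f : Fin n → Fin n) k → liftℕ f (toℕ k) ≡ toℕ (f k)
  liftℕ-toℕ f k = trans (liftℕ-fromℕ< f (toℕ<n k)) (cong (toℕ ∘ f) (fromℕ<-toℕ k (toℕ<n k)))

  ∀-toℕ⇒∀-< : ∀ {n} {P : ℕ → Set} → (∀ (k : Fin n) → P (toℕ k)) → ∀ m → m < n → P m
  ∀-toℕ⇒∀-< {P = P} h m m<n = subst P (toℕ-fromℕ< m<n) (h (fromℕ< m<n))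

  goodForm-of-word : ∀ {n} i (V : Fin n → Fin n) d e → d < i → i + e < n →
                     V ≗ wordProd (desc i d ++ asc i e) → GoodForm i V
  goodForm-of-word i V zero    zero    _   _     V≗ = inj₁ V≗
  goodForm-of-word i V (suc d) zero    d<i _     V≗ =
    inj₂ (inj₁ (suc d , z<s , d<i , λ k → trans (V≗ k) (cong (λ ws → wordProd ws k) (++-identityʳ (desc i (suc d))))))
  goodForm-of-word i V zero    (suc e) _   i+e<n V≗ = inj₂ (inj₂ (inj₁ (suc e , z<s , i+e<n , V≗)))
  goodForm-of-word i V (suc d) (suc e) d<i i+e<n V≗ =
    inj₂ (inj₂ (inj₂ (suc d , suc e , z<s , d<i , z<s , i+e<n , V≗)))

  module TargetWord {n} (i₁ up down : ℕ) (i<n : suc i₁ < n) (up<i : up < suc i₁)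
                    (i≤down : suc i₁ ≤ down) (down<n : down < n) where

    private
      i : ℕ
      i = suc i₁

    d e : ℕ
    d = i₁ ∸ up
    e = down ∸ i

    d<i : d < i
    d<i = s≤s (m∸n≤m i₁ up)

    i+e≡down : i + e ≡ down
    i+e≡down = m+[n∸m]≡n i≤down

    D A : ℕ → ℕ
    D = wordProdℕ (desc i d)
    A = wordProdℕ (asc i e)

    D-cycle : CyclesDown up i D
    D-cycle = subst (λ lo → CyclesDown lo i D) (m∸[m∸n]≡n (≤-pred up<i)) (desc-cycle i₁ d (m∸n≤m i₁ up))

    A-cycle : CyclesUp i down A
    A-cycle = subst (λ hi → CyclesUp i hi A) i+e≡down (asc-cycle e i)

    toℕ-wordProd-target : ∀ (k : Fin n) → toℕ (wordProd (desc i d ++ asc i e) k) ≡ D (A (toℕ k))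
    toℕ-wordProd-target k = trans (cong toℕ (wordProd-++ (desc i d) (asc i e) k))
                              (trans (toℕ-wordProd (desc i d) _ desc<n) (cong D (toℕ-wordProd (asc i e) k asc<n)))
      where
      desc<n : All (_< n) (desc i d)
      desc<n = subst (All (_< n)) (sym (map-upTo (i ∸_) (suc d)))
                 (Allₚ.applyUpTo⁺₁ (i ∸_) (suc d) (λ {t} _ → ≤-<-trans (m∸n≤m i t) i<n))
      asc<n : All (_< n) (asc i e)
      asc<n = subst (All (_< n)) (sym (map-upTo (λ t → i + suc t) e))
                (Allₚ.applyUpTo⁺₁ _ e (λ t<e → ≤-<-trans (+-monoʳ-≤ i t<e) (subst (_< n) (sym i+e≡down) down<n)))

  module LiftedFromFin {n} (i₁ : ℕ) (i<n : suc i₁ < n) (V V⁻¹ : Fin n → Fin n)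
    (VV⁻¹ : ∀ k → V (V⁻¹ k) ≡ k) (V⁻¹V : ∀ k → V⁻¹ (V k) ≡ k) (crossing : SingleCrossing (suc i₁) V)
    (sorted : ∀ p q → toℕ q ≡ suc (toℕ p) → toℕ q ≢ suc i₁ → toℕ (V⁻¹ p) < toℕ (V⁻¹ q)) where

    open SingleCrossing crossing

    private
      i : ℕ
      i = suc i₁

    u v : ℕ → ℕ
    u = liftℕ V⁻¹
    v = liftℕ V

    u<n : ∀ m → m < n → u m < n
    u<n = ∀-toℕ⇒∀-< (λ k → subst (_< n) (sym (liftℕ-toℕ V⁻¹ k)) (toℕ<n _))

    v<n : ∀ m → m < n → v m < n
    v<n = ∀-toℕ⇒∀-< (λ k → subst (_< n) (sym (liftℕ-toℕ V k)) (toℕ<n _))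

    u∘v : ∀ m → m < n → u (v m) ≡ m
    u∘v = ∀-toℕ⇒∀-< (λ k → trans (cong u (liftℕ-toℕ V k)) (trans (liftℕ-toℕ V⁻¹ (V k)) (cong toℕ (V⁻¹V k))))

    v∘u : ∀ m → m < n → v (u m) ≡ m
    v∘u = ∀-toℕ⇒∀-< (λ k → trans (cong v (liftℕ-toℕ V⁻¹ k)) (trans (liftℕ-toℕ V (V⁻¹ k)) (cong toℕ (VV⁻¹ k))))

    v-lower-stable : ∀ m → m < n → m < i → m ≢ toℕ up → v m < i
    v-lower-stable = ∀-toℕ⇒∀-< (λ k k<i k≢up →
      subst (_< i) (sym (liftℕ-toℕ V k)) (lower-stable k (k≢up ∘ cong toℕ) k<i))

    v-upper-stable : ∀ m → m < n → i ≤ m → m ≢ toℕ down → i ≤ v m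
    v-upper-stable = ∀-toℕ⇒∀-< (λ k i≤k k≢down →
      subst (i ≤_) (sym (liftℕ-toℕ V k)) (upper-stable k (k≢down ∘ cong toℕ) i≤k))

    u-sorted : ∀ m → suc m < n → suc m ≢ i → u m < u (suc m)
    u-sorted m 1+m<n = ∀-toℕ⇒∀-< {P = λ m → suc m < n → suc m ≢ i → u m < u (suc m)}
      (λ p 1+p<n 1+p≢i → let q = fromℕ< 1+p<n in
        subst₂ _<_ (sym (liftℕ-toℕ V⁻¹ p)) (trans (sym (liftℕ-toℕ V⁻¹ q)) (cong u (toℕ-fromℕ< 1+p<n)))
          (sorted p q (toℕ-fromℕ< 1+p<n) (1+p≢i ∘ trans (sym (toℕ-fromℕ< 1+p<n)))))
      m (<-trans (n<1+n m) 1+m<n) 1+m<n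

    open Lifted n i₁ (toℕ up) (toℕ down) u v u<n v<n u∘v v∘u i<n up<i i≤down (toℕ<n down)
      (subst (i ≤_) (sym (liftℕ-toℕ V up)) i≤V-up) (subst (_< i) (sym (liftℕ-toℕ V down)) V-down<i)
      v-lower-stable v-upper-stable u-sorted public

  sortedCrossing⇒goodForm : ∀ {n} i₁ → suc i₁ < n → (V V⁻¹ : Fin n → Fin n) →
    (∀ k → V (V⁻¹ k) ≡ k) → (∀ k → V⁻¹ (V k) ≡ k) → SingleCrossing (suc i₁) V →
    (∀ p q → toℕ q ≡ suc (toℕ p) → toℕ q ≢ suc i₁ → toℕ (V⁻¹ p) < toℕ (V⁻¹ q)) →
    GoodForm (suc i₁) V
  sortedCrossing⇒goodForm {n} i₁ i<n V V⁻¹ VV⁻¹ V⁻¹V crossing sorted =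
    goodForm-of-word (suc i₁) V d e d<i (subst (_< n) (sym i+e≡down) (toℕ<n down)) (λ k → toℕ-injective (begin
      toℕ (V k)              ≡⟨ liftℕ-toℕ V k ⟨
      v (toℕ k)              ≡⟨ cong v (u-cycles D-cycle A-cycle (toℕ k) (toℕ<n k)) ⟨
      v (u (D (A (toℕ k))))  ≡⟨ v∘u _ (subst (_< n) (toℕ-wordProd-target k) (toℕ<n _)) ⟩
      D (A (toℕ k))          ≡⟨ toℕ-wordProd-target k ⟨
      toℕ (wordProd (desc (suc i₁) d ++ asc (suc i₁) e) k) ∎))
    where
    open SingleCrossing crossing using (up; down; up<i; i≤down)
    open LiftedFromFin i₁ i<n V V⁻¹ VV⁻¹ V⁻¹V crossing sorted using (u; v; v∘u; u-cycles)
    open TargetWord {n} i₁ (toℕ up) (toℕ down) i<n up<i i≤down (toℕ<n down)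
    open ≡-Reasoning

module FiniteSums {a ℓ} (M : CommutativeMonoid a ℓ) where
  open CommutativeMonoid M renaming (refl to ≈-refl; sym to ≈-sym; trans to ≈-trans)
  open CommutativeMonoidSum M using (sum; sum-remove; sum-cong-≋; sum-replicate-zero)
  open CommutativeMonoidSolver M using (solve; _⊕_; _⊜_)
  open SetoidReasoning setoid

  sum-single : ∀ {n} {f : Fin n → Carrier} j → (∀ k → k ≢ j → f k ≈ ε) → sum f ≈ f j
  sum-single {suc n} {f} j f≈0 = begin
    sum f                      ≈⟨ sum-remove {i = j} f ⟩
    f j ∙ sum (f ∘ punchIn j)  ≈⟨ ∙-congˡ (sum-cong-≋ {n} (λ k → f≈0 (punchIn j k) (punchInᵢ≢i j k))) ⟩
    f j ∙ sum {n} (λ _ → ε)    ≈⟨ ∙-congˡ (sum-replicate-zero n) ⟩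
    f j ∙ ε                    ≈⟨ identityʳ (f j) ⟩
    f j                        ∎

  sum-agree-off₂ : ∀ {n} {f g : Fin n → Carrier} {p q} → p ≢ q → (∀ k → k ≢ p → k ≢ q → f k ≈ g k) →
                   sum f ∙ (g p ∙ g q) ≈ sum g ∙ (f p ∙ f q)
  sum-agree-off₂ {suc zero}    {p = Fin.zero} {Fin.zero} p≢q _ = ⊥-elim (p≢q refl)
  sum-agree-off₂ {suc (suc n)} {f} {g} {p} {q} p≢q f≈g = begin
    sum f ∙ (g p ∙ g q)               ≈⟨ ∙-cong (split f) ≈-refl ⟩
    (f p ∙ (f q ∙ rest f)) ∙ (g p ∙ g q)
      ≈⟨ ∙-cong (∙-congˡ (∙-congˡ (sum-cong-≋ (λ k → f≈g _ (avoids-p k) (avoids-q k))))) ≈-refl ⟩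
    (f p ∙ (f q ∙ rest g)) ∙ (g p ∙ g q)
      ≈⟨ solve 5 (λ a b c d r → (a ⊕ (b ⊕ r)) ⊕ (c ⊕ d) ⊜ (c ⊕ (d ⊕ r)) ⊕ (a ⊕ b)) ≈-refl
                 (f p) (f q) (g p) (g q) (rest g) ⟩
    (g p ∙ (g q ∙ rest g)) ∙ (f p ∙ f q) ≈⟨ ∙-cong (≈-sym (split g)) ≈-refl ⟩
    sum g ∙ (f p ∙ f q)               ∎
    where
    q′ : Fin (suc n)
    q′ = punchOut p≢q
    rest : (Fin (suc (suc n)) → Carrier) → Carrier
    rest h = sum (h ∘ punchIn p ∘ punchIn q′)
    split : ∀ h → sum h ≈ h p ∙ (h q ∙ rest h)
    split h = ≈-trans (sum-remove {i = p} h)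
                (∙-congˡ (≈-trans (sum-remove {i = q′} (h ∘ punchIn p))
                  (∙-cong (reflexive (cong h (punchIn-punchOut p≢q))) ≈-refl)))
    avoids-p : ∀ k → punchIn p (punchIn q′ k) ≢ p
    avoids-p k = punchInᵢ≢i p (punchIn q′ k)
    avoids-q : ∀ k → punchIn p (punchIn q′ k) ≢ q
    avoids-q k eq = punchInᵢ≢i q′ k (punchIn-injective p _ _ (trans eq (sym (punchIn-punchOut p≢q))))

module MatrixAlgebra {c ℓ} (E : Field c ℓ) where
  open Field E hiding (zero) renaming (refl to ≈-refl; sym to ≈-sym; trans to ≈-trans)
  open Matrices E
  open SemiringSum semiring using (sum; sum-cong-≋; ∑-distrib-+; ∑-comm; *-distribˡ-sum; *-distribʳ-sum)
  open FiniteSums +-commutativeMonoid using (sum-single)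

  private variable
    n : ℕ

  ∑≡sum : (f : Fin n → Carrier) → ∑ f ≡ sum f
  ∑≡sum {zero}  f = refl
  ∑≡sum {suc n} f = cong (f Fin.zero +_) (∑≡sum (f ∘ Fin.suc))

  ∑-cong : {f g : Fin n → Carrier} → (∀ k → f k ≈ g k) → ∑ f ≈ ∑ g
  ∑-cong {f = f} {g} f≈g = subst₂ _≈_ (sym (∑≡sum f)) (sym (∑≡sum g)) (sum-cong-≋ f≈g)

  ∑-+ : (f g : Fin n → Carrier) → ∑ (λ k → f k + g k) ≈ ∑ f + ∑ g
  ∑-+ f g rewrite ∑≡sum (λ k → f k + g k) | ∑≡sum f | ∑≡sum g = ∑-distrib-+ f g

  *-∑ : (x : Carrier) (f : Fin n → Carrier) → x * ∑ f ≈ ∑ (λ k → x * f k)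
  *-∑ x f rewrite ∑≡sum f | ∑≡sum (λ k → x * f k) = *-distribˡ-sum x f

  ∑-* : (x : Carrier) (f : Fin n → Carrier) → ∑ f * x ≈ ∑ (λ k → f k * x)
  ∑-* x f rewrite ∑≡sum f | ∑≡sum (λ k → f k * x) = *-distribʳ-sum x f

  ∑-∑ : ∀ {m} (f : Fin m → Fin n → Carrier) → ∑ (λ k → ∑ (f k)) ≈ ∑ (λ l → ∑ (λ k → f k l))
  ∑-∑ f = begin
    ∑ (λ k → ∑ (f k))              ≈⟨ ∑-cong (λ k → reflexive (∑≡sum (f k))) ⟩
    ∑ (λ k → sum (f k))            ≡⟨ ∑≡sum (λ k → sum (f k)) ⟩
    sum (λ k → sum (f k))          ≈⟨ ∑-comm f ⟩
    sum (λ l → sum (λ k → f k l))  ≡⟨ ∑≡sum (λ l → sum (λ k → f k l)) ⟨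
    ∑ (λ l → sum (λ k → f k l))    ≈⟨ ∑-cong (λ l → reflexive (∑≡sum (λ k → f k l))) ⟨
    ∑ (λ l → ∑ (λ k → f k l))      ∎
    where open SetoidReasoning setoid

  ∑-single : {f : Fin n → Carrier} (j : Fin n) → (∀ k → k ≢ j → f k ≈ 0#) → ∑ f ≈ f j
  ∑-single {f = f} j f≈0 rewrite ∑≡sum f = sum-single j f≈0

  ∑-zero : {f : Fin n → Carrier} → (∀ k → f k ≈ 0#) → ∑ f ≈ 0#
  ∑-zero {zero}  f≈0 = ≈-refl
  ∑-zero {suc n} f≈0 = ≈-trans (∑-single Fin.zero (λ k _ → f≈0 k)) (f≈0 Fin.zero)

  δ-diagonal : {k l : Fin n} → k ≡ l → δ k l ≈ 1#
  δ-diagonal {k = k} {l} k≡l with k Fin.≟ l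
  ... | yes _   = ≈-refl
  ... | no  k≢l = ⊥-elim (k≢l k≡l)

  δ-offDiagonal : {k l : Fin n} → k ≢ l → δ k l ≈ 0#
  δ-offDiagonal {k = k} {l} k≢l with k Fin.≟ l
  ... | yes k≡l = ⊥-elim (k≢l k≡l)
  ... | no  _   = ≈-refl

  δ-injective : (f : Fin n → Fin n) → (∀ {x y} → f x ≡ f y → x ≡ y) → (k l : Fin n) → δ (f k) (f l) ≈ δ k l
  δ-injective f f-injective k l with k Fin.≟ l
  ... | yes k≡l = δ-diagonal (cong f k≡l)
  ... | no  k≢l = δ-offDiagonal (k≢l ∘ f-injective)

  ∑-δʳ : (f : Fin n → Carrier) (l : Fin n) → ∑ (λ k → f k * δ k l) ≈ f l
  ∑-δʳ f l = ≈-trans (∑-single l (λ k k≢l → ≈-trans (*-congˡ (δ-offDiagonal k≢l)) (zeroʳ (f k))))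
                     (≈-trans (*-congˡ (δ-diagonal {k = l} refl)) (*-identityʳ (f l)))

  ∑-δˡ : (f : Fin n → Carrier) (k : Fin n) → ∑ (λ l → δ k l * f l) ≈ f k
  ∑-δˡ f k = ≈-trans (∑-single k (λ l l≢k → ≈-trans (*-congʳ (δ-offDiagonal (l≢k ∘ sym))) (zeroˡ (f l))))
                     (≈-trans (*-congʳ (δ-diagonal {k = k} refl)) (*-identityˡ (f k)))

  ≈ᴹ-setoid : ℕ → Setoid c ℓ
  ≈ᴹ-setoid n = record
    { Carrier       = Mat n
    ; _≈_           = _≈ᴹ_
    ; isEquivalence = record
      { refl  = λ _ _ → ≈-refl
      ; sym   = λ A≈B k l → ≈-sym (A≈B k l)
      ; trans = λ A≈B B≈C k l → ≈-trans (A≈B k l) (B≈C k l)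
      }
    }

  module ≈ᴹ-Reasoning {n} = SetoidReasoning (≈ᴹ-setoid n)

  ·-cong : {A A′ B B′ : Mat n} → A ≈ᴹ A′ → B ≈ᴹ B′ → (A · B) ≈ᴹ (A′ · B′)
  ·-cong A≈A′ B≈B′ k l = ∑-cong (λ j → *-cong (A≈A′ k j) (B≈B′ j l))

  ·-congˡ : (A : Mat n) {B B′ : Mat n} → B ≈ᴹ B′ → (A · B) ≈ᴹ (A · B′)
  ·-congˡ A = ·-cong {A = A} (λ _ _ → ≈-refl)

  ·-congʳ : {A A′ : Mat n} (B : Mat n) → A ≈ᴹ A′ → (A · B) ≈ᴹ (A′ · B)
  ·-congʳ B A≈A′ = ·-cong {B = B} A≈A′ (λ _ _ → ≈-refl)

  ·-assoc : (A B C : Mat n) → ((A · B) · C) ≈ᴹ (A · (B · C))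
  ·-assoc A B C k l = begin
    ∑ (λ j → ∑ (λ i → A k i * B i j) * C j l)   ≈⟨ ∑-cong (λ j → ∑-* (C j l) (λ i → A k i * B i j)) ⟩
    ∑ (λ j → ∑ (λ i → (A k i * B i j) * C j l)) ≈⟨ ∑-∑ (λ j i → (A k i * B i j) * C j l) ⟩
    ∑ (λ i → ∑ (λ j → (A k i * B i j) * C j l)) ≈⟨ ∑-cong (λ i → ∑-cong (λ j → *-assoc (A k i) (B i j) (C j l))) ⟩
    ∑ (λ i → ∑ (λ j → A k i * (B i j * C j l))) ≈⟨ ∑-cong (λ i → *-∑ (A k i) (λ j → B i j * C j l)) ⟨
    ∑ (λ i → A k i * ∑ (λ j → B i j * C j l))   ∎
    where open SetoidReasoning setoid

  ·-identityˡ : (A : Mat n) → (Id · A) ≈ᴹ A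
  ·-identityˡ A k l = ∑-δˡ (λ j → A j l) k

  ·-identityʳ : (A : Mat n) → (A · Id) ≈ᴹ A
  ·-identityʳ A k l = ∑-δʳ (A k) l

  invertible-· : {A B : Mat n} → Invertible A → Invertible B → Invertible (A · B)
  invertible-· {A = A} {B} (A⁻¹ , AA⁻¹ , A⁻¹A) (B⁻¹ , BB⁻¹ , B⁻¹B) = B⁻¹ · A⁻¹ , right , left
    where
    open ≈ᴹ-Reasoning
    right : ((A · B) · (B⁻¹ · A⁻¹)) ≈ᴹ Id
    right = begin
      (A · B) · (B⁻¹ · A⁻¹) ≈⟨ ·-assoc A B (B⁻¹ · A⁻¹) ⟩
      A · (B · (B⁻¹ · A⁻¹)) ≈⟨ ·-congˡ A (·-assoc B B⁻¹ A⁻¹) ⟨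
      A · ((B · B⁻¹) · A⁻¹) ≈⟨ ·-congˡ A (·-congʳ A⁻¹ BB⁻¹) ⟩
      A · (Id · A⁻¹)        ≈⟨ ·-congˡ A (·-identityˡ A⁻¹) ⟩
      A · A⁻¹               ≈⟨ AA⁻¹ ⟩
      Id                    ∎
    left : ((B⁻¹ · A⁻¹) · (A · B)) ≈ᴹ Id
    left = begin
      (B⁻¹ · A⁻¹) · (A · B) ≈⟨ ·-assoc B⁻¹ A⁻¹ (A · B) ⟩
      B⁻¹ · (A⁻¹ · (A · B)) ≈⟨ ·-congˡ B⁻¹ (·-assoc A⁻¹ A B) ⟨
      B⁻¹ · ((A⁻¹ · A) · B) ≈⟨ ·-congˡ B⁻¹ (·-congʳ B A⁻¹A) ⟩
      B⁻¹ · (Id · B)        ≈⟨ ·-congˡ B⁻¹ (·-identityˡ B) ⟩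
      B⁻¹ · B               ≈⟨ B⁻¹B ⟩
      Id                    ∎

  invertible-resp : {A B : Mat n} → A ≈ᴹ B → Invertible A → Invertible B
  invertible-resp {A = A} {B} A≈B (A⁻¹ , AA⁻¹ , A⁻¹A) =
    A⁻¹ , (λ k l → ≈-trans (·-congʳ A⁻¹ (λ i j → ≈-sym (A≈B i j)) k l) (AA⁻¹ k l))
        , (λ k l → ≈-trans (·-congˡ A⁻¹ (λ i j → ≈-sym (A≈B i j)) k l) (A⁻¹A k l))

  invertible-cancelʳ : {N A : Mat n} → Invertible (N · A) → Invertible A → Invertible N
  invertible-cancelʳ {N = N} {A} NA-invertible (A⁻¹ , AA⁻¹ , A⁻¹A) =
    invertible-resp NAA⁻¹≈N (invertible-· NA-invertible (A , A⁻¹A , AA⁻¹))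
    where
    open ≈ᴹ-Reasoning
    NAA⁻¹≈N : ((N · A) · A⁻¹) ≈ᴹ N
    NAA⁻¹≈N = begin
      (N · A) · A⁻¹ ≈⟨ ·-assoc N A A⁻¹ ⟩
      N · (A · A⁻¹) ≈⟨ ·-congˡ N AA⁻¹ ⟩
      N · Id        ≈⟨ ·-identityʳ N ⟩
      N             ∎

  upperTriangular-· : {A B : Mat n} → UpperTriangular A → UpperTriangular B → UpperTriangular (A · B)
  upperTriangular-· {A = A} {B} A-upper B-upper k l l<k = ∑-zero vanishes
    where
    vanishes : ∀ j → A k j * B j l ≈ 0#
    vanishes j with toℕ j <? toℕ k
    ... | yes j<k = ≈-trans (*-congʳ (A-upper k j j<k)) (zeroˡ (B j l))
    ... | no  j≮k = ≈-trans (*-congˡ (B-upper j l (ℕₚ.<-≤-trans l<k (ℕₚ.≮⇒≥ j≮k)))) (zeroʳ (A k j))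

  ·-permMat : (M : Mat n) (σ : Permutation′ n) (k l : Fin n) → (M · permMat σ) k l ≈ M k (σ ⟨$⟩ʳ l)
  ·-permMat M σ k l = ∑-δʳ (M k) (σ ⟨$⟩ʳ l)

  permMat-· : (σ : Permutation′ n) (M : Mat n) (k l : Fin n) → (permMat σ · M) k l ≈ M (σ ⟨$⟩ˡ k) l
  permMat-· σ M k l = ≈-trans (∑-single (σ ⟨$⟩ˡ k) vanishes)
                        (≈-trans (*-congʳ (δ-diagonal {k = k} (sym (inverseʳ σ)))) (*-identityˡ _))
    where
    vanishes : ∀ j → j ≢ σ ⟨$⟩ˡ k → δ k (σ ⟨$⟩ʳ j) * M j l ≈ 0#
    vanishes j j≢ = ≈-trans (*-congʳ (δ-offDiagonal (λ k≡ → j≢ (trans (sym (inverseˡ σ)) (cong (σ ⟨$⟩ˡ_) (sym k≡))))))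
                            (zeroˡ _)

  permMat-·-flip : (σ : Permutation′ n) → (permMat σ · permMat (Perm.flip σ)) ≈ᴹ Id
  permMat-·-flip σ k l = ≈-trans (permMat-· σ (permMat (Perm.flip σ)) k l)
    (δ-injective (σ ⟨$⟩ˡ_) (λ eq → trans (sym (inverseʳ σ)) (trans (cong (σ ⟨$⟩ʳ_) eq) (inverseʳ σ))) k l)

  permMat-invertible : (σ : Permutation′ n) → Invertible (permMat σ)
  permMat-invertible σ = permMat (Perm.flip σ) , permMat-·-flip σ , permMat-·-flip (Perm.flip σ)

  elementary : Fin n → Fin n → Carrier → Mat n
  elementary m m′ x k l = δ k l + δ k m * (δ l m′ * x)

  ·-elementary : (M : Mat n) (m m′ : Fin n) (x : Carrier) (k l : Fin n) →
                 (M · elementary m m′ x) k l ≈ M k l + M k m * (δ l m′ * x)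
  ·-elementary M m m′ x k l = begin
    ∑ (λ j → M k j * (δ j l + δ j m * (δ l m′ * x)))
      ≈⟨ ∑-cong (λ j → ≈-trans (distribˡ (M k j) _ _) (+-congˡ (≈-sym (*-assoc (M k j) (δ j m) _)))) ⟩
    ∑ (λ j → M k j * δ j l + (M k j * δ j m) * (δ l m′ * x))
      ≈⟨ ∑-+ (λ j → M k j * δ j l) (λ j → (M k j * δ j m) * (δ l m′ * x)) ⟩
    ∑ (λ j → M k j * δ j l) + ∑ (λ j → (M k j * δ j m) * (δ l m′ * x))
      ≈⟨ +-cong (∑-δʳ (M k) l) (≈-trans (≈-sym (∑-* (δ l m′ * x) (λ j → M k j * δ j m))) (*-congʳ (∑-δʳ (M k) m))) ⟩
    M k l + M k m * (δ l m′ * x) ∎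
    where open SetoidReasoning setoid

  elementary-inverse : {m m′ : Fin n} {x y : Carrier} → m ≢ m′ → x + y ≈ 0# →
                       (elementary m m′ x · elementary m m′ y) ≈ᴹ Id
  elementary-inverse {m = m} {m′} {x} {y} m≢m′ x+y≈0 k l = begin
    (elementary m m′ x · elementary m m′ y) k l
      ≈⟨ ·-elementary (elementary m m′ x) m m′ y k l ⟩
    elementary m m′ x k l + elementary m m′ x k m * (δ l m′ * y)
      ≈⟨ +-congˡ (*-congʳ column-m) ⟩
    (δ k l + δ k m * (δ l m′ * x)) + δ k m * (δ l m′ * y)
      ≈⟨ +-assoc _ _ _ ⟩
    δ k l + (δ k m * (δ l m′ * x) + δ k m * (δ l m′ * y))
      ≈⟨ +-congˡ (≈-sym (≈-trans (*-congˡ (distribˡ _ _ _)) (distribˡ _ _ _))) ⟩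
    δ k l + δ k m * (δ l m′ * (x + y))
      ≈⟨ +-congˡ (≈-trans (*-congˡ (≈-trans (*-congˡ x+y≈0) (zeroʳ _))) (zeroʳ _)) ⟩
    δ k l + 0#
      ≈⟨ +-identityʳ _ ⟩
    δ k l ∎
    where
    open SetoidReasoning setoid
    column-m : elementary m m′ x k m ≈ δ k m
    column-m = ≈-trans (+-congˡ (≈-trans (*-congˡ (≈-trans (*-congʳ (δ-offDiagonal m≢m′)) (zeroˡ x))) (zeroʳ _)))
                       (+-identityʳ _)

  elementary-invertible : {m m′ : Fin n} (x : Carrier) → m ≢ m′ → Invertible (elementary m m′ x)
  elementary-invertible x m≢m′ = elementary _ _ (- x)
    , elementary-inverse m≢m′ (-‿inverseʳ x) , elementary-inverse m≢m′ (-‿inverseˡ x)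

  elementary-upperTriangular : {m m′ : Fin n} (x : Carrier) → toℕ m < toℕ m′ → UpperTriangular (elementary m m′ x)
  elementary-upperTriangular {m = m} {m′} x m<m′ k l l<k =
    ≈-trans (+-cong (δ-offDiagonal (ℕₚ.<⇒≢ l<k ∘ cong toℕ ∘ sym)) off-diagonal) (+-identityˡ 0#)
    where
    off-diagonal : δ k m * (δ l m′ * x) ≈ 0#
    off-diagonal = by-row (k Fin.≟ m)
      where
      by-row : Dec (k ≡ m) → δ k m * (δ l m′ * x) ≈ 0#
      by-row (no  k≢m) = ≈-trans (*-congʳ (δ-offDiagonal k≢m)) (zeroˡ _)
      by-row (yes refl) = ≈-trans (*-congˡ (≈-trans (*-congʳ (δ-offDiagonal l≢m′)) (zeroˡ x))) (zeroʳ _)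
        where
        l≢m′ : l ≢ m′
        l≢m′ refl = ℕₚ.<-asym l<k m<m′

  module _ {b : Mat n} (b-upper : UpperTriangular b) (C : Mat n) (Cb≈Id : (C · b) ≈ᴹ Id) where

    LowerColumn : Fin n → Set ℓ
    LowerColumn j = (∀ i → toℕ j < toℕ i → C i j ≈ 0#) × (C j j * b j j ≈ 1#)

    lowerColumn-step : ∀ j → (∀ k → toℕ k < toℕ j → LowerColumn k) → LowerColumn j
    lowerColumn-step j earlier = below , diagonal
      where
      column : ∀ i → toℕ j ≤ toℕ i → C i j * b j j ≈ δ i j
      column i j≤i = ≈-trans (≈-sym (∑-single j vanishes)) (Cb≈Id i j)
        where
        vanishes : ∀ k → k ≢ j → C i k * b k j ≈ 0#
        vanishes k k≢j with toℕ k <? toℕ j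
        ... | yes k<j = ≈-trans (*-congʳ (proj₁ (earlier k k<j) i (ℕₚ.<-≤-trans k<j j≤i))) (zeroˡ _)
        ... | no  k≮j = ≈-trans (*-congˡ (b-upper k j (ℕₚ.≤∧≢⇒< (ℕₚ.≮⇒≥ k≮j) (k≢j ∘ toℕ-injective ∘ sym)))) (zeroʳ _)
      diagonal : C j j * b j j ≈ 1#
      diagonal = ≈-trans (column j ℕₚ.≤-refl) (δ-diagonal {k = j} refl)
      below : ∀ i → toℕ j < toℕ i → C i j ≈ 0#
      below i j<i = begin
        C i j                   ≈⟨ *-identityʳ _ ⟨
        C i j * 1#              ≈⟨ *-congˡ (≈-trans (*-comm _ _) diagonal) ⟨
        C i j * (b j j * C j j) ≈⟨ *-assoc _ _ _ ⟨
        (C i j * b j j) * C j j ≈⟨ *-congʳ (≈-trans (column i (ℕₚ.<⇒≤ j<i))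
                                      (δ-offDiagonal (ℕₚ.<⇒≢ j<i ∘ cong toℕ ∘ sym))) ⟩
        0# * C j j              ≈⟨ zeroˡ _ ⟩
        0#                      ∎
        where open SetoidReasoning setoid

    lowerColumn : ∀ j → LowerColumn j
    lowerColumn j = go j (FinInduction.<-wellFounded j)
      where
      go : ∀ j → Acc Fin._<_ j → LowerColumn j
      go j (acc earlier) = lowerColumn-step j (λ k k<j → go k (earlier k<j))

  diagonal-invertible : {b : Mat n} → InB b → ∀ j → ∃[ y ] (b j j * y ≈ 1#)
  diagonal-invertible (b-upper , C , _ , Cb≈Id) j =
    C j j , ≈-trans (*-comm _ _) (proj₂ (lowerColumn b-upper C Cb≈Id j))

module AdjacentTransposition {n} (p q : Fin n) (q≡1+p : toℕ q ≡ suc (toℕ p)) where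
  open ℕₚ
  open Transpositions
  open Words

  private
    a : ℕ
    a = toℕ p

  τ : Fin n → Fin n
  τ = s (suc a)

  1+a<n : suc a < n
  1+a<n = subst (_< n) q≡1+p (toℕ<n q)

  toℕ-τ : ∀ k → toℕ (τ k) ≡ swapℕ (suc a) (toℕ k)
  toℕ-τ k = toℕ-s (suc a) k 1+a<n

  τ-involutive : ∀ k → τ (τ k) ≡ k
  τ-involutive k = s-involutive (suc a) k 1+a<n

  τ-permutation : Permutation′ n
  τ-permutation = permutation τ τ τ-involutive τ-involutive

  p≢q : p ≢ q
  p≢q p≡q = 1+n≢n (trans (sym q≡1+p) (cong toℕ (sym p≡q)))

  τ-p : τ p ≡ q
  τ-p = toℕ-injective (trans (toℕ-τ p) (trans (swapℕ-lower a) (sym q≡1+p)))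

  τ-q : τ q ≡ p
  τ-q = toℕ-injective (trans (toℕ-τ q) (trans (cong (swapℕ (suc a)) q≡1+p) (swapℕ-upper a)))

  τ-fixes : ∀ k → k ≢ p → k ≢ q → τ k ≡ k
  τ-fixes k k≢p k≢q = toℕ-injective (trans (toℕ-τ k)
    (swapℕ-other a (k≢p ∘ toℕ-injective) (k≢q ∘ toℕ-injective ∘ flip trans (sym q≡1+p))))

  τ-preserves-order : ∀ k l → toℕ l < toℕ k → ¬ (l ≡ p × k ≡ q) → toℕ (τ l) < toℕ (τ k)
  τ-preserves-order k l l<k not-pq = subst₂ _<_ (sym (toℕ-τ l)) (sym (toℕ-τ k))
    (swapℕ-preserves-order a l<k (λ (l≡a , k≡1+a) →
      not-pq (toℕ-injective l≡a , toℕ-injective (trans k≡1+a (sym q≡1+p)))))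

  τ-preservesBlocks : ∀ {i} → toℕ q ≢ i → PreservesBlocks i τ
  τ-preservesBlocks q≢i = s-preservesBlocks (suc a) 1+a<n (q≢i ∘ trans q≡1+p)

module BruhatCellSwap {c ℓ} (E : Field c ℓ) {n} (p q : Fin n) (q≡1+p : toℕ q ≡ suc (toℕ p)) where
  open Field E hiding (zero) renaming (refl to ≈-refl; sym to ≈-sym; trans to ≈-trans)
  open Matrices E
  open MatrixAlgebra E
  open AdjacentTransposition p q q≡1+p
  open GroupProperties +-group using (//-rightDividesˡ)
  open RingProperties ring using (-0#≈0#)

  Pτ : Mat n
  Pτ = permMat τ-permutation

  module _ (b₁ : Mat n) (b₁∈B : InB b₁) (w : Permutation′ n) (m<m′ : toℕ (w ⟨$⟩ˡ p) < toℕ (w ⟨$⟩ˡ q)) where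

    private
      m m′ : Fin n
      m  = w ⟨$⟩ˡ p
      m′ = w ⟨$⟩ˡ q

      y x : Carrier
      y = proj₁ (diagonal-invertible b₁∈B p)
      x = b₁ p q * y

    -- Conjugating b₁ by τ leaves one entry below the diagonal, at (q, p); b₁′ clears it by a column
    -- operation, which reappears right of (τ w)˙ as the upper triangular factor elementary m m′ x
    -- because w⁻¹ p < w⁻¹ q.
    b₁′ : Mat n
    b₁′ k l = b₁ (τ k) (τ l) - (x * b₁ (τ k) p) * δ l p

    b₁′-upperTriangular : UpperTriangular b₁′
    b₁′-upperTriangular k l l<k = by-cases (l Fin.≟ p) (k Fin.≟ q)
      where
      open SetoidReasoning setoid
      b₁-upper : UpperTriangular b₁
      b₁-upper = proj₁ b₁∈B
      correction-vanishes : Dec (l ≡ p) → ¬ (l ≡ p × k ≡ q) → (x * b₁ (τ k) p) * δ l p ≈ 0#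
      correction-vanishes (no  l≢p)  _      = ≈-trans (*-congˡ (δ-offDiagonal l≢p)) (zeroʳ _)
      correction-vanishes (yes refl) not-pq = ≈-trans (*-congʳ (≈-trans (*-congˡ below-diagonal) (zeroʳ x))) (zeroˡ _)
        where
        below-diagonal : b₁ (τ k) p ≈ 0#
        below-diagonal rewrite τ-fixes k (ℕₚ.<⇒≢ l<k ∘ cong toℕ ∘ sym) (λ k≡q → not-pq (refl , k≡q)) =
          b₁-upper k p l<k
      generic : ¬ (l ≡ p × k ≡ q) → b₁′ k l ≈ 0#
      generic not-pq = begin
        b₁ (τ k) (τ l) - (x * b₁ (τ k) p) * δ l p
          ≈⟨ +-cong (b₁-upper (τ k) (τ l) (τ-preserves-order k l l<k not-pq))
                    (-‿cong (correction-vanishes (l Fin.≟ p) not-pq)) ⟩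
        0# - 0#  ≈⟨ -‿inverseʳ 0# ⟩
        0#       ∎
      corner : b₁′ q p ≈ 0#
      corner = begin
        b₁ (τ q) (τ p) - (x * b₁ (τ q) p) * δ p p
          ≈⟨ +-cong (reflexive (cong₂ b₁ τ-q τ-p))
                    (-‿cong (*-cong (*-congˡ (reflexive (cong (λ r → b₁ r p) τ-q))) (δ-diagonal {k = p} refl))) ⟩
        b₁ p q - ((b₁ p q * y) * b₁ p p) * 1#
          ≈⟨ +-congˡ (-‿cong (≈-trans (*-identityʳ _) (≈-trans (*-assoc _ _ _)
               (≈-trans (*-congˡ (≈-trans (*-comm _ _) (proj₂ (diagonal-invertible b₁∈B p)))) (*-identityʳ _))))) ⟩
        b₁ p q - b₁ p q ≈⟨ -‿inverseʳ _ ⟩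
        0# ∎
      by-cases : Dec (l ≡ p) → Dec (k ≡ q) → b₁′ k l ≈ 0#
      by-cases (yes refl) (yes refl) = corner
      by-cases (no  l≢p)  _          = generic (λ (l≡p , _) → l≢p l≡p)
      by-cases _          (no  k≢q)  = generic (λ (_ , k≡q) → k≢q k≡q)


    τw : Permutation′ n
    τw = w ∘ₚ τ-permutation

    δ-τw : ∀ l → δ (τ (w ⟨$⟩ʳ l)) p ≈ δ l m′
    δ-τw l = by-cases (l Fin.≟ m′)
      where
      by-cases : Dec (l ≡ m′) → δ (τ (w ⟨$⟩ʳ l)) p ≈ δ l m′
      by-cases (yes refl) = ≈-trans (δ-diagonal (trans (cong τ (inverseʳ w)) τ-q)) (≈-sym (δ-diagonal {k = m′} refl))
      by-cases (no  l≢m′) = ≈-trans (δ-offDiagonal τwl≢p) (≈-sym (δ-offDiagonal l≢m′))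
        where
        τwl≢p : τ (w ⟨$⟩ʳ l) ≢ p
        τwl≢p τwl≡p = l≢m′ (trans (sym (inverseˡ w))
                              (cong (w ⟨$⟩ˡ_) (trans (sym (τ-involutive _)) (trans (cong τ τwl≡p) τ-p))))

    b₁′-column-τwm : ∀ k → b₁′ k (τ (w ⟨$⟩ʳ m)) ≈ b₁ (τ k) p
    b₁′-column-τwm k = begin
      b₁ (τ k) (τ (τ (w ⟨$⟩ʳ m))) - (x * b₁ (τ k) p) * δ (τ (w ⟨$⟩ʳ m)) p
        ≈⟨ +-cong (reflexive (cong (b₁ (τ k)) (trans (τ-involutive _) (inverseʳ w))))
                  (-‿cong (≈-trans (*-congˡ (δ-offDiagonal τwm≢p)) (zeroʳ _))) ⟩
      b₁ (τ k) p - 0# ≈⟨ +-congˡ -0#≈0# ⟩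
      b₁ (τ k) p + 0# ≈⟨ +-identityʳ _ ⟩
      b₁ (τ k) p      ∎
      where
      open SetoidReasoning setoid
      τwm≢p : τ (w ⟨$⟩ʳ m) ≢ p
      τwm≢p eq = p≢q (sym (trans (sym τ-p) (trans (cong τ (sym (inverseʳ w))) eq)))

    b₁′-factorisation : ((Pτ · b₁) · permMat w) ≈ᴹ ((b₁′ · permMat τw) · elementary m m′ x)
    b₁′-factorisation k l = ≈-sym (begin
      ((b₁′ · permMat τw) · elementary m m′ x) k l
        ≈⟨ ·-elementary (b₁′ · permMat τw) m m′ x k l ⟩
      (b₁′ · permMat τw) k l + (b₁′ · permMat τw) k m * (δ l m′ * x)
        ≈⟨ +-cong (·-permMat b₁′ τw k l) (*-congʳ (≈-trans (·-permMat b₁′ τw k m) (b₁′-column-τwm k))) ⟩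
      b₁′ k (τ (w ⟨$⟩ʳ l)) + z * (D * x)
        ≈⟨ +-congʳ (+-cong (reflexive (cong (b₁ (τ k)) (τ-involutive _))) (-‿cong (*-congˡ (δ-τw l)))) ⟩
      (B - (x * z) * D) + z * (D * x)
        ≈⟨ +-congˡ (≈-trans (*-congˡ (*-comm D x)) (≈-trans (≈-sym (*-assoc z x D)) (*-congʳ (*-comm z x)))) ⟩
      (B - (x * z) * D) + (x * z) * D
        ≈⟨ //-rightDividesˡ ((x * z) * D) B ⟩
      B ≈⟨ permMat-· τ-permutation b₁ k (w ⟨$⟩ʳ l) ⟨
      (Pτ · b₁) k (w ⟨$⟩ʳ l)
        ≈⟨ ·-permMat (Pτ · b₁) w k l ⟨
      ((Pτ · b₁) · permMat w) k l ∎)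
      where
      open SetoidReasoning setoid
      z D B : Carrier
      z = b₁ (τ k) p
      D = δ l m′
      B = b₁ (τ k) (w ⟨$⟩ʳ l)

    private
      m≢m′ : m ≢ m′
      m≢m′ m≡m′ = ℕₚ.<-irrefl (cong toℕ m≡m′) m<m′

    b₁′-invertible : Invertible b₁′
    b₁′-invertible = invertible-cancelʳ
      (invertible-cancelʳ (invertible-resp b₁′-factorisation left-invertible) (elementary-invertible x m≢m′))
      (permMat-invertible τw)
      where
      left-invertible : Invertible ((Pτ · b₁) · permMat w)
      left-invertible =
        invertible-· (invertible-· (permMat-invertible τ-permutation) (proj₂ b₁∈B)) (permMat-invertible w)

    bruhatCell-swap : (F : Mat n) (R : Permutation′ n) (b₂ : Mat n) → InB b₂ →
                      gMat F R ≈ᴹ ((b₁ · permMat w) · b₂) → InBruhatCell (gMat F (τ-permutation ∘ₚ R)) τw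
    bruhatCell-swap F R b₂ b₂∈B g≈ =
      b₁′ , elementary m m′ x · b₂ , (b₁′-upperTriangular , b₁′-invertible) ,
      (upperTriangular-· (elementary-upperTriangular x m<m′) (proj₁ b₂∈B) ,
       invertible-· (elementary-invertible x m≢m′) (proj₂ b₂∈B)) ,
      (begin
        gMat F (τ-permutation ∘ₚ R)
          ≈⟨ (λ k l → ≈-trans (g≈ (τ k) l) (≈-sym (permMat-· τ-permutation ((b₁ · permMat w) · b₂) k l))) ⟩
        Pτ · ((b₁ · permMat w) · b₂)            ≈⟨ ·-assoc Pτ (b₁ · permMat w) b₂ ⟨
        (Pτ · (b₁ · permMat w)) · b₂            ≈⟨ ·-congʳ b₂ (·-assoc Pτ b₁ (permMat w)) ⟨
        ((Pτ · b₁) · permMat w) · b₂            ≈⟨ ·-congʳ b₂ b₁′-factorisation ⟩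
        ((b₁′ · permMat τw) · elementary m m′ x) · b₂ ≈⟨ ·-assoc (b₁′ · permMat τw) (elementary m m′ x) b₂ ⟩
        (b₁′ · permMat τw) · (elementary m m′ x · b₂) ∎)
      where open ≈ᴹ-Reasoning

  isRelPos-swap : (F : Mat n) (R w : Permutation′ n) → toℕ (w ⟨$⟩ˡ p) < toℕ (w ⟨$⟩ˡ q) →
                  IsRelPos F R w → IsRelPos F (τ-permutation ∘ₚ R) (w ∘ₚ τ-permutation)
  isRelPos-swap F R w m<m′ (b₁ , b₂ , b₁∈B , b₂∈B , g≈) = bruhatCell-swap b₁ b₁∈B w m<m′ F R b₂ b₂∈B g≈

module Potential where
  open ℕₚ
  open Nat using (_+_; _*_)
  open CommutativeMonoidSum +-0-commutativeMonoid using (sum)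
  open FiniteSums +-0-commutativeMonoid using (sum-agree-off₂)

  -- Rearrangement inequality: Σ x · u(x) drops when an ascent of u at adjacent positions is swapped.
  Φ : ∀ {n} → (Fin n → Fin n) → ℕ
  Φ u = sum (λ x → toℕ x * toℕ (u x))

  private
    cancel-swapped : ∀ Φ′ Φ P A B → Φ′ + (P * A + suc P * B) ≡ Φ + (P * B + suc P * A) → Φ′ + B ≡ Φ + A
    cancel-swapped Φ′ Φ P A B eq = +-cancelʳ-≡ (P * A + P * B) (Φ′ + B) (Φ + A)
      (trans (left Φ′ P A B) (trans eq (right Φ P A B)))
      where
      left : ∀ Φ′ P A B → Φ′ + B + (P * A + P * B) ≡ Φ′ + (P * A + suc P * B)
      left = solve-∀
      right : ∀ Φ P A B → Φ + (P * B + suc P * A) ≡ Φ + A + (P * A + P * B)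
      right = solve-∀

  module _ {n} (p q : Fin n) (q≡1+p : toℕ q ≡ suc (toℕ p)) where
    open AdjacentTransposition p q q≡1+p

    Φ-swap : ∀ u → Φ (u ∘ τ) + toℕ (u q) ≡ Φ u + toℕ (u p)
    Φ-swap u = cancel-swapped (Φ (u ∘ τ)) (Φ u) (toℕ p) (toℕ (u p)) (toℕ (u q)) (begin
      Φ (u ∘ τ) + (toℕ p * toℕ (u p) + suc (toℕ p) * toℕ (u q))
        ≡⟨ cong (λ t → Φ (u ∘ τ) + (toℕ p * toℕ (u p) + t * toℕ (u q))) q≡1+p ⟨
      Φ (u ∘ τ) + (toℕ p * toℕ (u p) + toℕ q * toℕ (u q))
        ≡⟨ sum-agree-off₂ p≢q (λ k k≢p k≢q → cong (λ r → toℕ k * toℕ (u r)) (τ-fixes k k≢p k≢q)) ⟩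
      Φ u + (toℕ p * toℕ (u (τ p)) + toℕ q * toℕ (u (τ q)))
        ≡⟨ cong₂ (λ a b → Φ u + (toℕ p * toℕ (u a) + toℕ q * toℕ (u b))) τ-p τ-q ⟩
      Φ u + (toℕ p * toℕ (u q) + toℕ q * toℕ (u p))
        ≡⟨ cong (λ t → Φ u + (toℕ p * toℕ (u q) + t * toℕ (u p))) q≡1+p ⟩
      Φ u + (toℕ p * toℕ (u q) + suc (toℕ p) * toℕ (u p)) ∎)
      where open ≡-Reasoning

    Φ-decreasing : ∀ u → toℕ (u p) < toℕ (u q) → Φ (u ∘ τ) < Φ u
    Φ-decreasing u up<uq = +-cancelʳ-< (toℕ (u q)) (Φ (u ∘ τ)) (Φ u)
      (subst (_< Φ u + toℕ (u q)) (sym (Φ-swap u)) (+-monoʳ-< (Φ u) up<uq))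

module Descent {c ℓ} (E : Field c ℓ) {n} (F : Matrices.Mat E n) (i₁ : ℕ) (i<n : suc i₁ < n) (I : Subset n) where
  open ℕₚ
  open Matrices E using (IsRelPos)
  open SingleCrossings
  open SortedCrossings using (sortedCrossing⇒goodForm)
  open Potential
  open BruhatCellSwap E using (isRelPos-swap)

  private
    i : ℕ
    i = suc i₁

  V-of : Permutation′ n → Fin n → Fin n
  V-of w k = w ⟨$⟩ʳ w₀ k

  Ascent : Permutation′ n → Set
  Ascent w = ∃[ p ] ∃[ q ] (toℕ q ≡ suc (toℕ p) × toℕ q ≢ i × toℕ (w ⟨$⟩ˡ p) < toℕ (w ⟨$⟩ˡ q))

  ascent? : ∀ w → Dec (Ascent w)
  ascent? w = any? λ p → any? λ q →
    (toℕ q Nat.≟ suc (toℕ p)) ×-dec ¬? (toℕ q Nat.≟ i) ×-dec (toℕ (w ⟨$⟩ˡ p) <? toℕ (w ⟨$⟩ˡ q))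

  compatible-swap : ∀ {p q R} (q≡1+p : toℕ q ≡ suc (toℕ p)) → toℕ q ≢ i → Compatible i I R →
                    Compatible i I (AdjacentTransposition.τ-permutation p q q≡1+p ∘ₚ R)
  compatible-swap {p} {q} {R} q≡1+p q≢i compatible j = mk⇔
    (λ j∈I → let (k , k<i , Rk≡j) = Equivalence.to (compatible j) j∈I in
             τ k , τ< k k<i , trans (cong (R ⟨$⟩ʳ_) (τ-involutive k)) Rk≡j)
    (λ (k , k<i , Rτk≡j) → Equivalence.from (compatible j) (τ k , τ< k k<i , Rτk≡j))
    where
    open AdjacentTransposition p q q≡1+p
    τ< : ∀ k → toℕ k < i → toℕ (τ k) < i
    τ< = proj₁ (τ-preservesBlocks q≢i)

  no-ascent⇒sorted : ∀ w → ¬ Ascent w → ∀ p q → toℕ q ≡ suc (toℕ p) → toℕ q ≢ i →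
                     toℕ (w₀ (w ⟨$⟩ˡ p)) < toℕ (w₀ (w ⟨$⟩ˡ q))
  no-ascent⇒sorted w no-ascent p q q≡1+p q≢i =
    subst₂ _<_ (sym (opposite-prop (w ⟨$⟩ˡ p))) (sym (opposite-prop (w ⟨$⟩ˡ q)))
      (∸-monoʳ-< (s≤s w⁻¹q<w⁻¹p) (toℕ<n (w ⟨$⟩ˡ p)))
    where
    w⁻¹p≢w⁻¹q : toℕ (w ⟨$⟩ˡ p) ≢ toℕ (w ⟨$⟩ˡ q)
    w⁻¹p≢w⁻¹q eq = AdjacentTransposition.p≢q p q q≡1+p
      (trans (sym (inverseʳ w)) (trans (cong (w ⟨$⟩ʳ_) (toℕ-injective eq)) (inverseʳ w)))
    w⁻¹q<w⁻¹p : toℕ (w ⟨$⟩ˡ q) < toℕ (w ⟨$⟩ˡ p)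
    w⁻¹q<w⁻¹p = ≤∧≢⇒< (≮⇒≥ (λ lt → no-ascent (p , q , q≡1+p , q≢i , lt))) (w⁻¹p≢w⁻¹q ∘ sym)

  Goal : Set (c Level.⊔ ℓ)
  Goal = ∃[ R′ ] (Compatible i I R′ × ∃[ w′ ] (IsRelPos F R′ w′ × GoodForm i (V-of w′)))

  descend : ∀ fuel R w → Φ (w ⟨$⟩ˡ_) < fuel → Compatible i I R → IsRelPos F R w → SingleCrossing i (V-of w) → Goal
  descend (suc fuel) R w Φ<fuel compatible relPos crossing with ascent? w
  ... | yes (p , q , q≡1+p , q≢i , ascent) =
    descend fuel (τ-permutation ∘ₚ R) (w ∘ₚ τ-permutation)
      (<-≤-trans (Φ-decreasing p q q≡1+p (w ⟨$⟩ˡ_) ascent) (≤-pred Φ<fuel))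
      (compatible-swap {R = R} q≡1+p q≢i compatible)
      (isRelPos-swap p q q≡1+p F R w ascent relPos)
      (singleCrossing-∘ˡ (τ-preservesBlocks q≢i) crossing)
    where open AdjacentTransposition p q q≡1+p
  ... | no no-ascent =
    R , compatible , w , relPos ,
    sortedCrossing⇒goodForm i₁ i<n (V-of w) (w₀ ∘ (w ⟨$⟩ˡ_))
      (λ k → trans (cong (w ⟨$⟩ʳ_) (opposite-involutive _)) (inverseʳ w))
      (λ k → trans (cong w₀ (inverseˡ w)) (opposite-involutive k))
      crossing (no-ascent⇒sorted w no-ascent)

open Nat using (_+_)
open SingleCrossings using (singleCrossing-resp-≗; wordProd-singleCrossing)

propositionA5 : ∀ {c ℓ : Level} (E : Field c ℓ) (n : ℕ) → 2 ≤ n →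
    (F : Matrices.Mat E n) → Matrices.Invertible E F →
    (i : ℕ) → 1 ≤ i → i + 1 ≤ n →
    (I : Subset n) → ∣ I ∣ ≡ i →
    (R : Permutation′ n) → Compatible i I R →
    (w : Permutation′ n) → Matrices.IsRelPos E F R w →
    (∃[ ws ] (ReducedExpr (λ k → w ⟨$⟩ʳ (w₀ k)) ws × count i ws ≡ 1)) →
    ∃[ R′ ] (Compatible i I R′ × ∃[ w′ ] (Matrices.IsRelPos E F R′ w′ ×
      GoodForm i (λ k → w′ ⟨$⟩ʳ (w₀ k))))
propositionA5 E n _ F _ (suc i₁) _ i+1≤n I _ R compatible w relPos (ws , (valid , ws≗V , _) , count≡1) =
  descend (suc (Φ (w ⟨$⟩ˡ_))) R w ℕₚ.≤-refl compatible relPos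
    (singleCrossing-resp-≗ ws≗V (wordProd-singleCrossing i₁ i<n ws valid count≡1))
  where
  i<n : suc i₁ < n
  i<n = subst (_≤ n) (ℕₚ.+-comm (suc i₁) 1) i+1≤n
  open Descent E F i₁ i<n I using (descend)
  open Potential using (Φ)
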